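{- At any stage of the Algorithm described in the context, applied to $G_{P,h,C_P}$, let $v$ be the value of the current flow, let $p=|p(t_{n+1})|$ (absolute value of the current potential of the sink), and let $P_p$ be the number of indices $i\in\{1,\ldots,n\}$ such that $p(t_i)=p(b_i)\in\{ -p+1,-p+2,\ldots,0\}$. Then $P_p + A'_v \ge n + vp$.
   Context: Let $P$ be a finite poset on a set $S_P$ of $n$ elements, $h: S_P\to\{1,\ldots,n\}$ a bijection, and $C_P\subseteq S_P\times S_P$ a set of pairs of distinct elements such that: (1) if $x<y$ in $P$ and $h(x)<h(y)$ then $(x,y)\in C_P$; (2) if $(x,y)\in C_P$ then $h(x)<h(y)$; (3) $C_P$ is transitive. A sequence $s_1,\ldots,s_m$ of distinct elements of $S_P$ is adjacentable if $(s_j,s_{j+1})\in C_P$ for all $j$; $asc(S)$ of such a sequence is the number of $j$ with $s_j<s_{j+1}$ in $P$, plus one ($0$ if $S$ is empty); $A'_v$ is the maximum of $asc(S_1)+\cdots+asc(S_v)$ over all sets of $v$ pairwise disjoint adjacentable sequences. The directed graph $G_{P,h,C_P}=(V,E)$ has $2n+2$ vertices: a source $b_0$, a sink $t_{n+1}$, and vertices $t_i,b_i$ for $1\le i\le n$. Its edges are: $(b_0,t_i)$, $(b_i,t_{n+1})$, $(t_i,b_i)$ for $1\le i\le n$, and $(b_i,t_j)$ whenever $(h^{ -1}(i),h^{ -1}(j))\in C_P$. Every edge has capacity $u=1$. The cost $c((v,w))$ is $-1$ if $w=t_{n+1}$, or if $v=b_i$, $w=t_j$ with $h^{ -1}(i)<h^{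 -1}(j)$ in $P$ and $i<j$; all other edges have cost $0$. A flow is $f:E\to\mathbb{R}_{\ge 0}$ with $f\le u$ and conservation at every vertex other than $b_0,t_{n+1}$; its value is the total flow leaving $b_0$. A potential is $p:V\to\mathbb{R}$. Algorithm: (1) Initialize $f\equiv 0$ and $p(b_i)=p(t_i)=-i$ for all $i$. (2) Let $\bar E=\{(v,w):(v,w)\in E,\ p(w)-p(v)=c((v,w)),\ f((v,w))<u((v,w))\}\cup\{(w,v):(v,w)\in E,\ p(w)-p(v)=c((v,w)),\ f((v,w))>0\}$, and let $X$ be the set of vertices reachable from $b_0$ via edges of $\bar E$. If $t_{n+1}\in X$ go to step 3, else go to step 4. (3) Choose a path from $b_0$ to $t_{n+1}$ in $\bar E$ and augment the flow by $1$ along it (increase on edges of $E$ traversed forwards, decrease on edges traversed backwards); go to step 5. (4) Increase by $1$ the potential of every vertex not in $X$; go to step 5. (5) If the flow has maximum possible value, stop; otherwise return to step 2. -}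

module Defs where

open import Data.Nat as ℕ using (ℕ; zero; suc)
open import Data.Bool using (Bool; true; false; T; _∧_; if_then_else_)
open import Data.Fin using (Fin; toℕ)
open import Data.Integer as ℤ using (ℤ)
open import Data.Rational as ℚ using (ℚ; 0ℚ; 1ℚ)
open import Data.List using (List; []; _∷_; map)
open import Data.List.Relation.Unary.All using (All)
open import Data.List.Relation.Unary.Unique.Propositional using (Unique)
open import Data.List.Membership.Propositional using (_∈_; _∉_)
open import Data.Product using (Σ; ∃; _×_; _,_)
open import Data.Empty using (⊥)
open import Relation.Nullary using (¬_; ⌊_⌋)
open import Relation.Binary.PropositionalEquality using (_≡_; _≢_)
open import Function.Bundles using (_↔_; Inverse)

-- S_P is represented by Fin n.
-- The strict order x < y of P is the Bool-valued relation `lt`.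
-- h : S_P → {1,…,n} is a bijection S_P ↔ Fin n, where the value
-- k : Fin n stands for the label (toℕ k + 1).

record Setup (n : ℕ) : Set where
  field
    lt        : Fin n → Fin n → Bool
    lt-irrefl : ∀ x → T (lt x x) → ⊥
    lt-trans  : ∀ x y z → T (lt x y) → T (lt y z) → T (lt x z)
    h         : Fin n ↔ Fin n
    C         : Fin n → Fin n → Bool
    C-distinct : ∀ x y → T (C x y) → x ≢ y
    cond1 : ∀ x y → T (lt x y) → toℕ (Inverse.to h x) ℕ.< toℕ (Inverse.to h y) → T (C x y)
    cond2 : ∀ x y → T (C x y) → toℕ (Inverse.to h x) ℕ.< toℕ (Inverse.to h y)
    cond3 : ∀ x y z → T (C x y) → T (C y z) → T (C x z)

  hinv : Fin n → Fin n
  hinv = Inverse.from h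

Σℕ : ∀ {n} → (Fin n → ℕ) → ℕ
Σℕ {zero}  f = 0
Σℕ {suc n} f = f Fin.zero ℕ.+ Σℕ (λ i → f (Fin.suc i))
  where import Data.Fin as Fin

Σℚ : ∀ {n} → (Fin n → ℚ) → ℚ
Σℚ {zero}  f = 0ℚ
Σℚ {suc n} f = f Fin.zero ℚ.+ Σℚ (λ i → f (Fin.suc i))
  where import Data.Fin as Fin

countFin : ∀ {n} → (Fin n → Bool) → ℕ
countFin b = Σℕ (λ i → if b i then 1 else 0)

module Sequences {n : ℕ} (S : Setup n) where
  open Setup S

  Adjacentable : List (Fin n) → Set
  Adjacentable [] = Data.Unit.⊤
    where import Data.Unit
  Adjacentable (x ∷ []) = Data.Unit.⊤
    where import Data.Unit
  Adjacentable (x ∷ y ∷ r) = T (C x y) × Adjacentable (y ∷ r)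

  ascPairs : List (Fin n) → ℕ
  ascPairs [] = 0
  ascPairs (x ∷ []) = 0
  ascPairs (x ∷ y ∷ r) = (if lt x y then 1 else 0) ℕ.+ ascPairs (y ∷ r)

  asc : List (Fin n) → ℕ
  asc [] = 0
  asc (x ∷ r) = suc (ascPairs (x ∷ r))

  IsFamily : (v : ℕ) → (Fin v → List (Fin n)) → Set
  IsFamily v F =
    (∀ k → Unique (F k) × Adjacentable (F k)) ×
    (∀ k l → k ≢ l → ∀ x → x ∈ F k → x ∉ F l)

  totalAsc : (v : ℕ) → (Fin v → List (Fin n)) → ℕ
  totalAsc v F = Σℕ (λ k → asc (F k))

  IsA' : ℕ → ℕ → Set
  IsA' v m =
    (Σ (Fin v → List (Fin n)) λ F → IsFamily v F × totalAsc v F ≡ m) ×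
    (∀ F → IsFamily v F → totalAsc v F ℕ.≤ m)

-- The network G_{P,h,C_P}.  Vertex tv i / bv i (i : Fin n) is t_{i+1} / b_{i+1};
-- src is b_0 and sink is t_{n+1}.

data Vtx (n : ℕ) : Set where
  src sink : Vtx n
  tv bv    : Fin n → Vtx n

module Network {n : ℕ} (S : Setup n) where
  open Setup S

  data Edge : Set where
    eS : Fin n → Edge
    eT : Fin n → Edge
    eM : Fin n → Edge
    eC : (i j : Fin n) → T (C (hinv i) (hinv j)) → Edge

  tail head : Edge → Vtx n
  tail (eS i) = src
  tail (eT i) = bv i
  tail (eM i) = tv i
  tail (eC i j _) = bv i
  head (eS i) = tv i
  head (eT i) = sink
  head (eM i) = bv i
  head (eC i j _) = tv j

  cost : Edge → ℤ
  cost (eS i) = ℤ.0ℤ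
  cost (eT i) = ℤ.-1ℤ
  cost (eM i) = ℤ.0ℤ
  cost (eC i j _) =
    if lt (hinv i) (hinv j) ∧ ⌊ toℕ i ℕ.<? toℕ j ⌋ then ℤ.-1ℤ else ℤ.0ℤ

  guard : (b : Bool) → (T b → ℚ) → ℚ
  guard true  k = k _
  guard false k = 0ℚ

  -- A (real-valued) flow; reals are replaced by rationals here
  IsQFlow : (Edge → ℚ) → Set
  IsQFlow g =
    (∀ e → 0ℚ ℚ.≤ g e × g e ℚ.≤ 1ℚ) ×
    (∀ j → g (eS j) ℚ.+ Σℚ (λ i → guard (C (hinv i) (hinv j)) (λ c → g (eC i j c)))
           ≡ g (eM j)) ×
    (∀ i → g (eM i)
           ≡ g (eT i) ℚ.+ Σℚ (λ j → guard (C (hinv i) (hinv j)) (λ c → g (eC i j c))))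

  valueQ : (Edge → ℚ) → ℚ
  valueQ g = Σℚ (λ i → g (eS i))

  -- State of the algorithm: current flow (integral, as produced by the
  -- algorithm) and current potential.
  record State : Set where
    constructor ⟨_,_⟩
    field
      flow : Edge → ℕ
      pot  : Vtx n → ℤ
  open State public

  value : State → ℕ
  value st = Σℕ (λ i → flow st (eS i))

  IsMaxFlow : State → Set
  IsMaxFlow st = ∀ g → IsQFlow g → valueQ g ℚ.≤ (ℤ.+ value st) ℚ./ 1

  label : Vtx n → ℕ
  label src = 0
  label sink = suc n
  label (tv i) = suc (toℕ i)
  label (bv i) = suc (toℕ i)

  initial : State
  initial = ⟨ (λ _ → 0) , (λ x → ℤ.- (ℤ.+ label x)) ⟩

  data Arc : Set where
    fwd bwd : Edge → Arc

  asrc atgt : Arc → Vtx n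
  asrc (fwd e) = tail e
  asrc (bwd e) = head e
  atgt (fwd e) = head e
  atgt (bwd e) = tail e

  Tight : State → Edge → Set
  Tight st e = pot st (head e) ℤ.- pot st (tail e) ≡ cost e

  InĒ : State → Arc → Set
  InĒ st (fwd e) = Tight st e × flow st e ℕ.< 1
  InĒ st (bwd e) = Tight st e × 0 ℕ.< flow st e

  IsWalk : Vtx n → List Arc → Vtx n → Set
  IsWalk x [] y = x ≡ y
  IsWalk x (a ∷ as) y = asrc a ≡ x × IsWalk (atgt a) as y

  Reach : State → Vtx n → Set
  Reach st x = ∃ λ as → IsWalk src as x × All (InĒ st) as

  IsPath : State → List Arc → Set
  IsPath st as = IsWalk src as sink × All (InĒ st) as × Unique (src ∷ map atgt as)

  Augment : State → List Arc → (Edge → ℕ) → Set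
  Augment st as f' = ∀ e →
    (fwd e ∈ as → f' e ≡ suc (flow st e)) ×
    (bwd e ∈ as → suc (f' e) ≡ flow st e) ×
    (fwd e ∉ as → bwd e ∉ as → f' e ≡ flow st e)

  -- one pass through steps 2 and 3/4
  data Step (st : State) : State → Set where
    augment : ∀ st' → Reach st sink → (as : List Arc) → IsPath st as →
              Augment st as (flow st') → (∀ x → pot st' x ≡ pot st x) →
              Step st st'
    raise   : ∀ st' → ¬ Reach st sink → (∀ e → flow st' e ≡ flow st e) →
              (∀ x → (Reach st x → pot st' x ≡ pot st x) ×
                     (¬ Reach st x → pot st' x ≡ pot st x ℤ.+ ℤ.1ℤ)) →
              Step st st'

  -- the states that occur at some stage of the algorithm
  -- (after step 1, and after each execution of step 5 that does not stop)
  data Stage : State → Set where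
    start : Stage initial
    first : ∀ {st} → Step initial st → Stage st
    next  : ∀ {st st'} → Stage st → ¬ IsMaxFlow st → Step st st' → Stage st'

  Pcount : State → ℕ
  Pcount st = countFin λ i →
      ⌊ pot st (tv i) ℤ.≟ pot st (bv i) ⌋
    ∧ ⌊ ℤ.- (ℤ.+ p) ℤ.+ ℤ.1ℤ ℤ.≤? pot st (tv i) ⌋
    ∧ ⌊ pot st (tv i) ℤ.≤? ℤ.0ℤ ⌋
    where p = ℤ.∣ pot st sink ∣

-- The algorithm is a primal–dual method for min-cost flow, and every stage satisfies the
-- reduced-cost optimality conditions (edges with flow have p(w) − p(v) ≥ c, empty edges
-- have p(w) − p(v) ≤ c), together with p(b₀) = 0, p(t_{n+1}) ≤ 0, and p(t_i) = p(b_i)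
-- whenever no flow passes through i.  Augmenting along tight arcs preserves this, and so
-- does raising the potentials outside X, because no arc of Ē leaves X.
--
-- The flow then splits into v disjoint paths b₀ → t_a → b_a → t_j → b_j → … → t_{n+1}
-- whose labels increase, so their elements form v disjoint adjacentable sequences.  Along
-- such a path the potential starts at p(t_a) ≥ 0, ends at p(b) ≤ 1 − p, and can only drop,
-- by one, at an ascent; every index on the path that is not counted in P_p wastes one more
-- unit, so asc ≥ p + #(path ∖ P_p).  Every index not counted in P_p carries flow and hence
-- lies on a path, and summing over the v paths gives n − P_p + v p ≤ A′_v.

module Submission where

open import Defs
open import Data.Nat using (ℕ; _+_; _*_; _≥_)
open import Data.Integer using (∣_∣)
open import Data.Nat using (zero; suc; _≤_; _<_; z≤n; s≤s; pred)
import Data.Nat.Properties as ℕP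
open import Algebra.Properties.CommutativeSemigroup ℕP.+-commutativeSemigroup using (x∙yz≈y∙xz)
open import Data.Nat.ListAction using (sum)
import Data.Nat.ListAction.Properties as SumP
import Data.Nat.Tactic.RingSolver as ℕSolver
import Data.Nat.Coprimality as Coprime
open import Data.Integer as ℤ using (ℤ; +≤+; -≤+; -≤-; 0ℤ; 1ℤ; -1ℤ)
  renaming (_≤_ to _≤ℤ_; _<_ to _<ℤ_; _+_ to _+ℤ_; _-_ to _-ℤ_; -_ to -ℤ_)
import Data.Integer.Properties as ℤP
open import Data.Integer.Tactic.RingSolver using (solve-∀)
open import Data.Rational as ℚ using (ℚ; 1ℚ)
import Data.Rational.Properties as ℚP
open import Data.Rational.Unnormalised as ℚᵘ using (mkℚᵘ; *≤*; *≡*)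
import Data.Rational.Unnormalised.Properties as ℚᵘP
open import Data.Bool using (Bool; true; false; T; not; _∧_; if_then_else_)
open import Data.Bool.Properties using (T-irrelevant) renaming (_≟_ to _≟ᴮ_)
open import Data.Fin using (Fin; toℕ; cast) renaming (zero to fzero; suc to fsuc)
import Data.Fin.Properties as FinP
open import Data.List using (List; []; _∷_; map; length; lookup; _++_; concatMap)
import Data.List.Properties as ListP
open import Data.List.Membership.Propositional using (_∈_; _∉_)
import Data.List.Membership.Propositional.Properties as ∈P
import Data.List.Membership.DecPropositional as DecMembership
open import Data.List.Relation.Unary.Any using (here; there)
open import Data.List.Relation.Unary.All using (All; []; _∷_)
import Data.List.Relation.Unary.All as All
import Data.List.Relation.Unary.All.Properties as AllP
open import Data.List.Relation.Unary.AllPairs using ([]; _∷_)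
open import Data.List.Relation.Unary.Unique.Propositional using (Unique)
import Data.List.Relation.Unary.Unique.Propositional.Properties as UniqueP
open import Data.Maybe using (Maybe; just; nothing; maybe′)
open import Data.Product using (Σ; ∃; _×_; _,_; proj₁; proj₂)
import Data.Product.Properties as ×P
open import Data.Sum using (_⊎_; inj₁; inj₂)
import Data.Sum.Properties as ⊎P
open import Data.Empty using (⊥; ⊥-elim)
open import Relation.Nullary using (¬_; Dec; yes; no; ⌊_⌋)
open import Relation.Nullary.Decidable using (T?; decidable-stable; ¬¬-excluded-middle; via-injection)
open import Relation.Binary.Definitions using (DecidableEquality)
open import Function using (_∘_)
open import Function.Bundles using (Inverse; mk↣)
open import Relation.Binary.PropositionalEquality

ind : Bool → ℕ
ind b = if b then 1 else 0

Σℕ-cong : ∀ {m} {f g : Fin m → ℕ} → (∀ i → f i ≡ g i) → Σℕ f ≡ Σℕ g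
Σℕ-cong {zero}  f≗g = refl
Σℕ-cong {suc m} f≗g = cong₂ _+_ (f≗g fzero) (Σℕ-cong (f≗g ∘ fsuc))

Σℕ-zero : ∀ {m} {f : Fin m → ℕ} → (∀ i → f i ≡ 0) → Σℕ f ≡ 0
Σℕ-zero {zero}  f≗0 = refl
Σℕ-zero {suc m} f≗0 = cong₂ _+_ (f≗0 fzero) (Σℕ-zero (λ i → f≗0 (fsuc i)))

Σℕ-distrib-+ : ∀ {m} (f g : Fin m → ℕ) → Σℕ (λ i → f i + g i) ≡ Σℕ f + Σℕ g
Σℕ-distrib-+ {zero}  f g = refl
Σℕ-distrib-+ {suc m} f g = begin
  f fzero + g fzero + Σℕ (λ i → f (fsuc i) + g (fsuc i))
    ≡⟨ cong (f fzero + g fzero +_) (Σℕ-distrib-+ (λ i → f (fsuc i)) (λ i → g (fsuc i))) ⟩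
  f fzero + g fzero + (Σℕ (λ i → f (fsuc i)) + Σℕ (λ i → g (fsuc i)))
    ≡⟨ interchange (f fzero) (g fzero) _ _ ⟩
  f fzero + Σℕ (λ i → f (fsuc i)) + (g fzero + Σℕ (λ i → g (fsuc i))) ∎
  where
  open ≡-Reasoning
  interchange : ∀ a b c d → a + b + (c + d) ≡ a + c + (b + d)
  interchange = ℕSolver.solve-∀

Σℕ-single : ∀ {m} (f : Fin m → ℕ) a → (∀ i → i ≢ a → f i ≡ 0) → Σℕ f ≡ f a
Σℕ-single {suc m} f fzero     others = trans (cong (f fzero +_) (Σℕ-zero (λ i → others (fsuc i) (λ ())))) (ℕP.+-identityʳ _)
Σℕ-single {suc m} f (fsuc a) others =
  cong₂ _+_ (others fzero (λ ()))
            (Σℕ-single (λ i → f (fsuc i)) a (λ i i≢a → others (fsuc i) (i≢a ∘ FinP.suc-injective)))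

term≤Σℕ : ∀ {m} (f : Fin m → ℕ) a → f a ≤ Σℕ f
term≤Σℕ {suc m} f fzero    = ℕP.m≤m+n _ _
term≤Σℕ {suc m} f (fsuc a) = ℕP.≤-trans (term≤Σℕ (λ i → f (fsuc i)) a) (ℕP.m≤n+m _ _)

two-terms≤Σℕ : ∀ {m} (f : Fin m → ℕ) a b → a ≢ b → f a + f b ≤ Σℕ f
two-terms≤Σℕ {suc m} f fzero    fzero    a≢b = ⊥-elim (a≢b refl)
two-terms≤Σℕ {suc m} f fzero    (fsuc b) a≢b = ℕP.+-monoʳ-≤ (f fzero) (term≤Σℕ (λ i → f (fsuc i)) b)
two-terms≤Σℕ {suc m} f (fsuc a) fzero    a≢b =
  ℕP.≤-trans (ℕP.≤-reflexive (ℕP.+-comm (f (fsuc a)) (f fzero)))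
             (ℕP.+-monoʳ-≤ (f fzero) (term≤Σℕ (λ i → f (fsuc i)) a))
two-terms≤Σℕ {suc m} f (fsuc a) (fsuc b) a≢b =
  ℕP.≤-trans (two-terms≤Σℕ (λ i → f (fsuc i)) a b (λ a≡b → a≢b (cong fsuc a≡b))) (ℕP.m≤n+m _ _)

Σℕ-pos⇒pos-term : ∀ {m} (f : Fin m → ℕ) → 1 ≤ Σℕ f → ∃ λ i → 1 ≤ f i
Σℕ-pos⇒pos-term {suc m} f pos with f fzero in eq
... | suc _ = fzero , subst (1 ≤_) (sym eq) (s≤s z≤n)
... | zero with Σℕ-pos⇒pos-term (λ i → f (fsuc i)) pos
...   | i , fi-pos = fsuc i , fi-pos

Σℕ<m⇒zero-term : ∀ {m} (f : Fin m → ℕ) → Σℕ f < m → ∃ λ i → f i ≡ 0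
Σℕ<m⇒zero-term {suc m} f small with f fzero in eq
... | zero = fzero , eq
... | suc k with Σℕ<m⇒zero-term (λ i → f (fsuc i)) (ℕP.≤-trans (s≤s (ℕP.m≤n+m _ k)) (ℕP.≤-pred small))
...   | i , fi≡0 = fsuc i , fi≡0

countFin-true+false : ∀ {m} (b : Fin m → Bool) → countFin b + countFin (λ i → not (b i)) ≡ m
countFin-true+false {zero}  b = refl
countFin-true+false {suc m} b with b fzero
... | true  = cong suc (countFin-true+false (λ i → b (fsuc i)))
... | false = trans (ℕP.+-suc _ _) (cong suc (countFin-true+false (λ i → b (fsuc i))))

≤1⇒0⊎1 : ∀ {m} → m ≤ 1 → m ≡ 0 ⊎ m ≡ 1
≤1⇒0⊎1 z≤n       = inj₁ refl
≤1⇒0⊎1 (s≤s z≤n) = inj₂ refl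

balance-transfer : ∀ {F′ B D F B′ A} → F′ + B + D ≡ F + B′ + A → F ≡ B → A ≡ D → F′ ≡ B′
balance-transfer {F′} {B} {D} {B′ = B′} eq refl refl =
  ℕP.+-cancelʳ-≡ B F′ B′ (trans (ℕP.+-cancelʳ-≡ D (F′ + B) (B + B′) eq) (ℕP.+-comm B B′))

m+n≤1⇒1≤n⇒m≡0 : ∀ m n → m + n ≤ 1 → 1 ≤ n → m ≡ 0
m+n≤1⇒1≤n⇒m≡0 m n m+n≤1 1≤n =
  ℕP.n≤0⇒n≡0 (ℕP.+-cancelʳ-≤ 1 m 0 (ℕP.≤-trans (ℕP.+-monoʳ-≤ m 1≤n) m+n≤1))

toℚᵘ-Σℚ≤size : ∀ m (g : Fin m → ℚ) → (∀ i → g i ℚ.≤ 1ℚ) →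
                ℚ.toℚᵘ (Σℚ g) ℚᵘ.≤ mkℚᵘ (ℤ.+ m) 0
toℚᵘ-Σℚ≤size zero    g g≤1 = *≤* (+≤+ z≤n)
toℚᵘ-Σℚ≤size (suc m) g g≤1 =
  ℚᵘP.≤-respˡ-≃ (ℚᵘP.≃-sym (ℚP.toℚᵘ-homo-+ (g fzero) (Σℚ (λ i → g (fsuc i)))))
    (ℚᵘP.≤-respʳ-≃ 1+m≃suc-m
      (ℚᵘP.+-mono-≤ (ℚP.toℚᵘ-mono-≤ (g≤1 fzero))
                    (toℚᵘ-Σℚ≤size m (λ i → g (fsuc i)) (λ i → g≤1 (fsuc i)))))
  where
  1+m≃suc-m : ℚ.toℚᵘ 1ℚ ℚᵘ.+ mkℚᵘ (ℤ.+ m) 0 ℚᵘ.≃ mkℚᵘ (ℤ.+ suc m) 0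
  1+m≃suc-m = *≡* (identity (ℤ.+ m))
    where
    identity : ∀ x → (1ℤ ℤ.* 1ℤ +ℤ x ℤ.* 1ℤ) ℤ.* 1ℤ ≡ (1ℤ +ℤ x) ℤ.* (1ℤ ℤ.* 1ℤ)
    identity = solve-∀

Σℚ≤size : ∀ m v (g : Fin m → ℚ) → (∀ i → g i ℚ.≤ 1ℚ) → m ≤ v → Σℚ g ℚ.≤ (ℤ.+ v) ℚ./ 1
Σℚ≤size m v g g≤1 m≤v = ℚP.toℚᵘ-cancel-≤ (ℚᵘP.≤-trans (toℚᵘ-Σℚ≤size m g g≤1)
  (subst (λ q → mkℚᵘ (ℤ.+ m) 0 ℚᵘ.≤ ℚ.toℚᵘ q) (sym (ℚP.normalize-coprime (Coprime.sym (Coprime.1-coprimeTo v))))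
    (*≤* (ℤP.*-monoʳ-≤-nonNeg (ℤ.+ 1) (+≤+ m≤v)))))

≤-rearrange : ∀ {L R A B : ℤ} → A ≤ℤ B → L +ℤ B ≡ R +ℤ A → L ≤ℤ R
≤-rearrange {L} {R} {A} h L+B≡R+A =
  subst₂ _≤ℤ_ (cancel L) (cancel R) (ℤP.+-monoˡ-≤ (-ℤ A) (subst (L +ℤ A ≤ℤ_) L+B≡R+A (ℤP.+-monoʳ-≤ L h)))
  where
  cancel : ∀ x → x +ℤ A +ℤ -ℤ A ≡ x
  cancel x = trans (ℤP.+-assoc x A (-ℤ A)) (trans (cong (x +ℤ_) (ℤP.+-inverseʳ A)) (ℤP.+-identityʳ x))

infixr 5 _⊕_
_⊕_ : ∀ {a b c d : ℤ} → a ≤ℤ b → c ≤ℤ d → a +ℤ c ≤ℤ b +ℤ d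
_⊕_ = ℤP.+-mono-≤

by-excluded-middle : ∀ {G R : Set} → Dec G → (Dec R → G) → G
by-excluded-middle G? k = decidable-stable G? (λ ¬G → ¬¬-excluded-middle (¬G ∘ k))

≡-dec-via-retraction : ∀ {A B : Set} (to : A → B) (from : B → A) → (∀ x → from (to x) ≡ x) →
                       DecidableEquality B → DecidableEquality A
≡-dec-via-retraction to from retract =
  via-injection (mk↣ (λ {x} {y} tx≡ty → trans (sym (retract x)) (trans (cong from tx≡ty) (retract y))))

three-tight : ∀ {a b s c : ℤ} → a ≤ℤ 0ℤ → 0ℤ ≤ℤ s → -1ℤ ≤ℤ c → c ≤ℤ a -ℤ b → s -ℤ b ≤ℤ -1ℤ →
              a ≡ 0ℤ × a -ℤ b ≡ c × s -ℤ b ≡ -1ℤ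
three-tight {a} {b} {s} {c} a≤0 0≤s -1≤c c≤a-b s-b≤-1 =
  ℤP.≤-antisym a≤0 (≤-rearrange (-1≤c ⊕ c≤a-b ⊕ 0≤s ⊕ s-b≤-1) (e₁ a b s c)) ,
  ℤP.≤-antisym (≤-rearrange (a≤0 ⊕ 0≤s ⊕ s-b≤-1 ⊕ -1≤c) (e₂ a b s c)) c≤a-b ,
  ℤP.≤-antisym s-b≤-1 (≤-rearrange (c≤a-b ⊕ a≤0 ⊕ -1≤c ⊕ 0≤s) (e₃ a b s c))
  where
  e₁ : ∀ a b s c → 0ℤ +ℤ (c +ℤ ((a -ℤ b) +ℤ (s +ℤ -1ℤ))) ≡ a +ℤ (-1ℤ +ℤ (c +ℤ (0ℤ +ℤ (s -ℤ b))))
  e₁ = solve-∀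
  e₂ : ∀ a b s c → (a -ℤ b) +ℤ (0ℤ +ℤ (s +ℤ (-1ℤ +ℤ c))) ≡ c +ℤ (a +ℤ (0ℤ +ℤ ((s -ℤ b) +ℤ -1ℤ)))
  e₂ = solve-∀
  e₃ : ∀ a b s c → -1ℤ +ℤ ((a -ℤ b) +ℤ (0ℤ +ℤ (c +ℤ s))) ≡ (s -ℤ b) +ℤ (c +ℤ (a +ℤ (-1ℤ +ℤ 0ℤ)))
  e₃ = solve-∀

-∣i∣≡i : ∀ {i} → i ≤ℤ 0ℤ → -ℤ (ℤ.+ ∣ i ∣) ≡ i
-∣i∣≡i {ℤ.+ zero}   _       = refl
-∣i∣≡i {ℤ.-[1+ m ]} _       = refl
-∣i∣≡i {ℤ.+ suc m}  (+≤+ ())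

-1≤i-j⇒j≤i+1 : ∀ {i j : ℤ} → -1ℤ ≤ℤ i -ℤ j → j ≤ℤ i +ℤ 1ℤ
-1≤i-j⇒j≤i+1 {i} {j} h = ≤-rearrange h (shuffle i j)
  where
  shuffle : ∀ i j → j +ℤ (i -ℤ j) ≡ i +ℤ 1ℤ +ℤ -1ℤ
  shuffle = solve-∀

i-j≤-1⇒i+1≤j : ∀ {i j : ℤ} → i -ℤ j ≤ℤ -1ℤ → i +ℤ 1ℤ ≤ℤ j
i-j≤-1⇒i+1≤j {i} {j} h = ≤-rearrange h (shuffle i j)
  where
  shuffle : ∀ i j → i +ℤ 1ℤ +ℤ -1ℤ ≡ j +ℤ (i -ℤ j)
  shuffle = solve-∀

positive : ℤ → ℕ
positive x = ind ⌊ 0ℤ ℤ.<? x ⌋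

positive-nonpos : ∀ {x} → x ≤ℤ 0ℤ → positive x ≡ 0
positive-nonpos {x} x≤0 with 0ℤ ℤ.<? x
... | yes 0<x = ⊥-elim (ℤP.<-irrefl refl (ℤP.<-≤-trans 0<x x≤0))
... | no  _   = refl

positive≤ : ∀ {x} → 0ℤ ≤ℤ x → ℤ.+ positive x ≤ℤ x
positive≤ {x} 0≤x with 0ℤ ℤ.<? x
... | yes 0<x = ℤP.i<j⇒suc[i]≤j 0<x
... | no  _   = 0≤x

levelIn : ℤ → ℤ → ℤ → Bool
levelIn s x y = ⌊ x ℤ.≟ y ⌋ ∧ ⌊ -ℤ (ℤ.+ ∣ s ∣) +ℤ 1ℤ ℤ.≤? x ⌋ ∧ ⌊ x ℤ.≤? 0ℤ ⌋

levelIn-true : ∀ {s x y} → s ≤ℤ 0ℤ → x ≡ y → s +ℤ 1ℤ ≤ℤ x → x ≤ℤ 0ℤ → levelIn s x y ≡ true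
levelIn-true {s} {x} {y} s≤0 x≡y s+1≤x x≤0 with x ℤ.≟ y
... | no x≢y = ⊥-elim (x≢y x≡y)
... | yes _ with -ℤ (ℤ.+ ∣ s ∣) +ℤ 1ℤ ℤ.≤? x
...   | no  ¬lower = ⊥-elim (¬lower (subst (λ z → z +ℤ 1ℤ ≤ℤ x) (sym (-∣i∣≡i s≤0)) s+1≤x))
...   | yes _ with x ℤ.≤? 0ℤ
...     | no  ¬upper = ⊥-elim (¬upper x≤0)
...     | yes _      = refl

levelOut : ℤ → ℤ → ℤ → ℤ
levelOut s x y = ℤ.+ ind (not (levelIn s x y))

levelOut-last : ∀ {s x y} → s ≤ℤ 0ℤ → x ≤ℤ y → y ≤ℤ s +ℤ 1ℤ →
                x +ℤ levelOut s x y ≤ℤ 1ℤ +ℤ s +ℤ ℤ.+ positive x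
levelOut-last {s} {x} {y} s≤0 x≤y y≤s+1 with x ℤ.≟ y
... | no x≢y =
  ≤-rearrange ((ℤP.i<j⇒suc[i]≤j (ℤP.≤∧≢⇒< x≤y x≢y) ⊕ y≤s+1) ⊕ +≤+ z≤n) (e x y s (ℤ.+ positive x))
  where
  e : ∀ x y s p → x +ℤ 1ℤ +ℤ (y +ℤ (s +ℤ 1ℤ) +ℤ p) ≡ 1ℤ +ℤ s +ℤ p +ℤ (1ℤ +ℤ x +ℤ y +ℤ 0ℤ)
  e = solve-∀
... | yes _ with -ℤ (ℤ.+ ∣ s ∣) +ℤ 1ℤ ℤ.≤? x
...   | no ¬lower = ≤-rearrange (x<s+1 ⊕ +≤+ z≤n) (e x s (ℤ.+ positive x))
  where
  x<s+1 : x +ℤ 1ℤ ≤ℤ s +ℤ 1ℤ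
  x<s+1 = subst (_≤ℤ s +ℤ 1ℤ) (ℤP.+-comm 1ℤ x)
            (ℤP.i<j⇒suc[i]≤j (subst (λ z → x <ℤ z +ℤ 1ℤ) (-∣i∣≡i s≤0) (ℤP.≰⇒> ¬lower)))
  e : ∀ x s p → x +ℤ 1ℤ +ℤ (s +ℤ 1ℤ +ℤ p) ≡ 1ℤ +ℤ s +ℤ p +ℤ (x +ℤ 1ℤ +ℤ 0ℤ)
  e = solve-∀
...   | yes _ with x ℤ.≤? 0ℤ | 0ℤ ℤ.<? x
...     | no ¬x≤0 | no ¬0<x = ⊥-elim (¬0<x (ℤP.≰⇒> ¬x≤0))
...     | no _    | yes _   = ≤-rearrange (ℤP.≤-trans x≤y y≤s+1) (e x s)
  where
  e : ∀ x s → x +ℤ 1ℤ +ℤ (s +ℤ 1ℤ) ≡ 1ℤ +ℤ s +ℤ 1ℤ +ℤ x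
  e = solve-∀
...     | yes _   | 0<x?    = ≤-rearrange (ℤP.≤-trans x≤y y≤s+1 ⊕ +≤+ z≤n) (e x s (ℤ.+ ind ⌊ 0<x? ⌋))
  where
  e : ∀ x s p → x +ℤ 0ℤ +ℤ (s +ℤ 1ℤ +ℤ p) ≡ 1ℤ +ℤ s +ℤ p +ℤ (x +ℤ 0ℤ)
  e = solve-∀

levelOut-middle : ∀ {s x y} → s ≤ℤ 0ℤ → x ≤ℤ y → s +ℤ 1ℤ ≤ℤ y →
                  x +ℤ levelOut s x y ≤ℤ y +ℤ ℤ.+ positive x
levelOut-middle {s} {x} {y} s≤0 x≤y s+1≤y with x ℤ.≟ y
... | no x≢y = ≤-rearrange (ℤP.i<j⇒suc[i]≤j (ℤP.≤∧≢⇒< x≤y x≢y) ⊕ +≤+ z≤n) (e x y (ℤ.+ positive x))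
  where
  e : ∀ x y p → x +ℤ 1ℤ +ℤ (y +ℤ p) ≡ y +ℤ p +ℤ (1ℤ +ℤ x +ℤ 0ℤ)
  e = solve-∀
... | yes refl with -ℤ (ℤ.+ ∣ s ∣) +ℤ 1ℤ ℤ.≤? x
...   | no ¬lower = ⊥-elim (¬lower (subst (λ z → z +ℤ 1ℤ ≤ℤ x) (sym (-∣i∣≡i s≤0)) s+1≤y))
...   | yes _ with x ℤ.≤? 0ℤ | 0ℤ ℤ.<? x
...     | no ¬x≤0 | no ¬0<x = ⊥-elim (¬0<x (ℤP.≰⇒> ¬x≤0))
...     | no _    | yes _   = ℤP.≤-refl
...     | yes _   | _       = ℤP.+-monoʳ-≤ x (+≤+ z≤n)

chain-step : ∀ {x b y q x′ B′ L a s} → x +ℤ b ≤ℤ y +ℤ q → -ℤ L ≤ℤ x′ -ℤ y → x′ +ℤ B′ ≤ℤ a +ℤ s →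
             x +ℤ (b +ℤ B′) ≤ℤ L +ℤ a +ℤ s +ℤ q
chain-step {x} {b} {y} {q} {x′} {B′} {L} {a} {s} h₁ h₂ h₃ = ≤-rearrange (h₁ ⊕ h₂ ⊕ h₃) (e x b y q x′ B′ L a s)
  where
  e : ∀ x b y q x′ B′ L a s → x +ℤ (b +ℤ B′) +ℤ (y +ℤ q +ℤ ((x′ -ℤ y) +ℤ (a +ℤ s)))
                              ≡ L +ℤ a +ℤ s +ℤ q +ℤ (x +ℤ b +ℤ (-ℤ L +ℤ (x′ +ℤ B′)))
  e = solve-∀

fzero∉map-fsuc : ∀ {m} {ys : List (Fin m)} → fzero ∉ map fsuc ys
fzero∉map-fsuc 0∈ with ∈P.∈-map⁻ fsuc 0∈
... | _ , _ , ()

fsuc∈map-fsuc⁻ : ∀ {m} {x} {ys : List (Fin m)} → fsuc x ∈ map fsuc ys → x ∈ ys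
fsuc∈map-fsuc⁻ x∈ with ∈P.∈-map⁻ fsuc x∈
... | _ , y∈ , refl = y∈

support : ∀ {m} → (Fin m → ℕ) → List (Fin m)
support {zero}  g = []
support {suc m} g with g fzero
... | zero  = map fsuc (support (g ∘ fsuc))
... | suc _ = fzero ∷ map fsuc (support (g ∘ fsuc))

length-support : ∀ {m} (g : Fin m → ℕ) → (∀ i → g i ≤ 1) → length (support g) ≡ Σℕ g
length-support {zero}  g g≤1 = refl
length-support {suc m} g g≤1 with g fzero | g≤1 fzero
... | zero        | _      = length-rest
  where length-rest = trans (ListP.length-map fsuc (support (g ∘ fsuc))) (length-support (g ∘ fsuc) (g≤1 ∘ fsuc))
... | suc zero    | _      = cong suc length-rest
  where length-rest = trans (ListP.length-map fsuc (support (g ∘ fsuc))) (length-support (g ∘ fsuc) (g≤1 ∘ fsuc))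
... | suc (suc _) | s≤s ()

∈-support⁻ : ∀ {m} (g : Fin m → ℕ) {x} → x ∈ support g → 1 ≤ g x
∈-support⁻ {suc m} g {fzero} 0∈ with g fzero | 0∈
... | zero  | 0∈′ = ⊥-elim (fzero∉map-fsuc 0∈′)
... | suc _ | _   = s≤s z≤n
∈-support⁻ {suc m} g {fsuc x} x∈ with g fzero | x∈
... | zero  | x∈′       = ∈-support⁻ (g ∘ fsuc) (fsuc∈map-fsuc⁻ x∈′)
... | suc _ | there x∈′ = ∈-support⁻ (g ∘ fsuc) (fsuc∈map-fsuc⁻ x∈′)

∈-support⁺ : ∀ {m} (g : Fin m → ℕ) {x} → 1 ≤ g x → x ∈ support g
∈-support⁺ {suc m} g {fzero}  pos with g fzero
... | suc _ = here refl
∈-support⁺ {suc m} g {fzero}  () | zero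
∈-support⁺ {suc m} g {fsuc x} pos with g fzero
... | zero  = ∈P.∈-map⁺ fsuc (∈-support⁺ (g ∘ fsuc) pos)
... | suc _ = there (∈P.∈-map⁺ fsuc (∈-support⁺ (g ∘ fsuc) pos))

support-unique : ∀ {m} (g : Fin m → ℕ) → Unique (support g)
support-unique {zero}  g = []
support-unique {suc m} g with g fzero
... | zero  = UniqueP.map⁺ FinP.suc-injective (support-unique (g ∘ fsuc))
... | suc _ = All.tabulate (λ x∈ 0≡x → fzero∉map-fsuc (subst (_∈ _) (sym 0≡x) x∈))
              ∷ UniqueP.map⁺ FinP.suc-injective (support-unique (g ∘ fsuc))

lookup-injective : ∀ {A : Set} {xs : List A} → Unique xs → ∀ i j → lookup xs i ≡ lookup xs j → i ≡ j
lookup-injective {xs = x ∷ xs} (x∉ ∷ u) fzero    fzero    _ = refl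
lookup-injective {xs = x ∷ xs} (x∉ ∷ u) fzero    (fsuc j) e = ⊥-elim (All.lookup x∉ (∈P.∈-lookup j) e)
lookup-injective {xs = x ∷ xs} (x∉ ∷ u) (fsuc i) fzero    e = ⊥-elim (All.lookup x∉ (∈P.∈-lookup i) (sym e))
lookup-injective {xs = x ∷ xs} (x∉ ∷ u) (fsuc i) (fsuc j) e = cong fsuc (lookup-injective u i j e)

cast-injective : ∀ {m k} (eq : m ≡ k) {i j : Fin m} → cast eq i ≡ cast eq j → i ≡ j
cast-injective eq {i} {j} e =
  trans (sym (FinP.cast-involutive (sym eq) eq i)) (trans (cong (cast (sym eq)) e) (FinP.cast-involutive (sym eq) eq j))

Σℕ-lookup : ∀ {A : Set} (xs : List A) {v} (eq : v ≡ length xs) (G : A → ℕ) →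
            Σℕ (λ k → G (lookup xs (cast eq k))) ≡ sum (map G xs)
Σℕ-lookup []       {zero}  eq G = refl
Σℕ-lookup (x ∷ xs) {suc v} eq G = cong (G x +_) (Σℕ-lookup xs (cong pred eq) G)

sum-map-shift-≤ : ∀ {A : Set} (H G : A → ℕ) c (as : List A) → (∀ {a} → a ∈ as → H a + c ≤ G a) →
                  sum (map H as) + length as * c ≤ sum (map G as)
sum-map-shift-≤ H G c []       bound = z≤n
sum-map-shift-≤ H G c (a ∷ as) bound =
  ℕP.≤-trans (ℕP.≤-reflexive (interchange (H a) (sum (map H as)) c (length as * c)))
    (ℕP.+-mono-≤ (bound (here refl)) (sum-map-shift-≤ H G c as (bound ∘ there)))
  where
  interchange : ∀ x y p q → x + y + (p + q) ≡ x + p + (y + q)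
  interchange = ℕSolver.solve-∀

dropZero : ∀ {m} → List (Fin (suc m)) → List (Fin m)
dropZero []            = []
dropZero (fzero  ∷ xs) = dropZero xs
dropZero (fsuc x ∷ xs) = x ∷ dropZero xs

∈-dropZero : ∀ {m} (xs : List (Fin (suc m))) {j} → fsuc j ∈ xs → j ∈ dropZero xs
∈-dropZero (fzero  ∷ xs) (there j∈) = ∈-dropZero xs j∈
∈-dropZero (fsuc x ∷ xs) (here refl) = here refl
∈-dropZero (fsuc x ∷ xs) (there j∈) = there (∈-dropZero xs j∈)

module _ {m : ℕ} (b : Fin (suc m) → Bool) where

  private
    count : List (Fin (suc m)) → ℕ
    count xs = sum (map (ind ∘ b) xs)

    countTail : List (Fin m) → ℕ
    countTail xs = sum (map (ind ∘ b ∘ fsuc) xs)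

  countTail-dropZero≤ : ∀ xs → countTail (dropZero xs) ≤ count xs
  countTail-dropZero≤ []            = z≤n
  countTail-dropZero≤ (fzero  ∷ xs) = ℕP.≤-trans (countTail-dropZero≤ xs) (ℕP.m≤n+m _ _)
  countTail-dropZero≤ (fsuc x ∷ xs) = ℕP.+-monoʳ-≤ (ind (b (fsuc x))) (countTail-dropZero≤ xs)

  head+countTail-dropZero≤ : ∀ xs → fzero ∈ xs → ind (b fzero) + countTail (dropZero xs) ≤ count xs
  head+countTail-dropZero≤ (fzero  ∷ xs) (here refl) = ℕP.+-monoʳ-≤ (ind (b fzero)) (countTail-dropZero≤ xs)
  head+countTail-dropZero≤ (fzero  ∷ xs) (there 0∈)  = ℕP.≤-trans (head+countTail-dropZero≤ xs 0∈) (ℕP.m≤n+m _ _)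
  head+countTail-dropZero≤ (fsuc x ∷ xs) (there 0∈)  = begin
    ind (b fzero) + (ind (b (fsuc x)) + countTail (dropZero xs))
      ≡⟨ x∙yz≈y∙xz (ind (b fzero)) (ind (b (fsuc x))) (countTail (dropZero xs)) ⟩
    ind (b (fsuc x)) + (ind (b fzero) + countTail (dropZero xs))
      ≤⟨ ℕP.+-monoʳ-≤ (ind (b (fsuc x))) (head+countTail-dropZero≤ xs 0∈) ⟩
    ind (b (fsuc x)) + count xs ∎
    where open ℕP.≤-Reasoning

  covered-head+countTail-dropZero≤ : ∀ xs → (T (b fzero) → fzero ∈ xs) → ind (b fzero) + countTail (dropZero xs) ≤ count xs
  covered-head+countTail-dropZero≤ xs covers₀ with b fzero in eq
  ... | false = countTail-dropZero≤ xs
  ... | true  = subst (λ b₀ → ind b₀ + countTail (dropZero xs) ≤ count xs) eq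
                      (head+countTail-dropZero≤ xs (covers₀ _))

countFin≤count-cover : ∀ {m} (b : Fin m → Bool) (xs : List (Fin m)) → (∀ i → T (b i) → i ∈ xs) →
                       countFin b ≤ sum (map (ind ∘ b) xs)
countFin≤count-cover {zero}  b xs covers = z≤n
countFin≤count-cover {suc m} b xs covers =
  ℕP.≤-trans (ℕP.+-monoʳ-≤ (ind (b fzero)) tail-bound) (covered-head+countTail-dropZero≤ b xs (covers fzero))
  where
  tail-bound = countFin≤count-cover (b ∘ fsuc) (dropZero xs) (λ i bi → ∈-dropZero xs (covers (fsuc i) bi))

Unique-++⁻ˡ : ∀ {A : Set} (xs : List A) {ys} → Unique (xs ++ ys) → Unique xs
Unique-++⁻ˡ []       u          = []
Unique-++⁻ˡ (x ∷ xs) (x∉ ∷ u) = AllP.++⁻ˡ xs x∉ ∷ Unique-++⁻ˡ xs u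

Unique-map⇒injective : ∀ {A B : Set} (g : A → B) {xs : List A} → Unique (map g xs) →
                       ∀ {x y} → x ∈ xs → y ∈ xs → g x ≡ g y → x ≡ y
Unique-map⇒injective g (gz∉ ∷ u) (here refl) (here refl) _   = refl
Unique-map⇒injective g (gz∉ ∷ u) (here refl) (there y∈) gx≡gy = ⊥-elim (All.lookup gz∉ (∈P.∈-map⁺ g y∈) gx≡gy)
Unique-map⇒injective g (gz∉ ∷ u) (there x∈) (here refl) gx≡gy =
  ⊥-elim (All.lookup gz∉ (∈P.∈-map⁺ g x∈) (sym gx≡gy))
Unique-map⇒injective g (gz∉ ∷ u) (there x∈) (there y∈) gx≡gy = Unique-map⇒injective g u x∈ y∈ gx≡gy

sum-map-concatMap : ∀ {A B : Set} (h : A → ℕ) (g : B → List A) xs →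
                    sum (map h (concatMap g xs)) ≡ sum (map (λ x → sum (map h (g x))) xs)
sum-map-concatMap h g []       = refl
sum-map-concatMap h g (x ∷ xs) = begin
  sum (map h (g x ++ concatMap g xs))              ≡⟨ cong sum (ListP.map-++ h (g x) (concatMap g xs)) ⟩
  sum (map h (g x) ++ map h (concatMap g xs))      ≡⟨ SumP.sum-++ (map h (g x)) (map h (concatMap g xs)) ⟩
  sum (map h (g x)) + sum (map h (concatMap g xs)) ≡⟨ cong (sum (map h (g x)) +_) (sum-map-concatMap h g xs) ⟩
  sum (map h (g x)) + sum (map (λ x → sum (map h (g x))) xs) ∎
  where open ≡-Reasoning

module Algorithm {n : ℕ} (S : Setup n) where
  open Setup S
  open Network S
  open Sequences S

  guardℕ : (b : Bool) → (T b → ℕ) → ℕ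
  guardℕ true  k = k _
  guardℕ false k = 0

  guardℕ-cong : ∀ b {k k′ : T b → ℕ} → (∀ c → k c ≡ k′ c) → guardℕ b k ≡ guardℕ b k′
  guardℕ-cong true  k≗k′ = k≗k′ _
  guardℕ-cong false k≗k′ = refl

  guardℕ-zero : ∀ b {k : T b → ℕ} → (∀ c → k c ≡ 0) → guardℕ b k ≡ 0
  guardℕ-zero true  k≗0 = k≗0 _
  guardℕ-zero false k≗0 = refl

  guardℕ-+ : ∀ b (k k′ : T b → ℕ) → guardℕ b (λ c → k c + k′ c) ≡ guardℕ b k + guardℕ b k′
  guardℕ-+ true  k k′ = refl
  guardℕ-+ false k k′ = refl

  guardℕ-at : ∀ b (k : T b → ℕ) c → guardℕ b k ≡ k c
  guardℕ-at true k c = refl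

  guardℕ-pos : ∀ b (k : T b → ℕ) → 1 ≤ guardℕ b k → Σ (T b) λ c → 1 ≤ k c
  guardℕ-pos true k pos = _ , pos

  flowC : (Edge → ℕ) → Fin n → Fin n → ℕ
  flowC f i j = guardℕ (C (hinv i) (hinv j)) (λ c → f (eC i j c))

  flow-eC≤flowC : ∀ f i j c → f (eC i j c) ≤ flowC f i j
  flow-eC≤flowC f i j c = ℕP.≤-reflexive (sym (guardℕ-at (C (hinv i) (hinv j)) (λ c → f (eC i j c)) c))

  Δ : State → Edge → ℤ
  Δ st e = pot st (head e) -ℤ pot st (tail e)

  hinv-inverse : ∀ i → Inverse.to h (hinv i) ≡ i
  hinv-inverse i = Inverse.strictlyInverseˡ h i

  hinv-injective : ∀ {i j} → hinv i ≡ hinv j → i ≡ j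
  hinv-injective {i} {j} eq = trans (sym (hinv-inverse i)) (trans (cong (Inverse.to h) eq) (hinv-inverse j))

  C⇒< : ∀ i j → T (C (hinv i) (hinv j)) → toℕ i < toℕ j
  C⇒< i j c = subst₂ (λ x y → toℕ x < toℕ y) (hinv-inverse i) (hinv-inverse j) (cond2 _ _ c)

  cost-eC : ∀ i j c → cost (eC i j c) ≡ -ℤ (ℤ.+ ind (lt (hinv i) (hinv j)))
  cost-eC i j c with lt (hinv i) (hinv j)
  ... | false = refl
  ... | true with toℕ i ℕP.<? toℕ j
  ...   | yes _   = refl
  ...   | no  i≮j = ⊥-elim (i≮j (C⇒< i j c))

  -1≤cost : ∀ e → -1ℤ ≤ℤ cost e
  -1≤cost (eS i) = -≤+
  -1≤cost (eT i) = -≤- z≤n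
  -1≤cost (eM i) = -≤+
  -1≤cost (eC i j c) rewrite cost-eC i j c with lt (hinv i) (hinv j)
  ... | true  = -≤- z≤n
  ... | false = -≤+

  data Side : Set where
    top bottom : Side

  node : Side → Fin n → Vtx n
  node top    = tv
  node bottom = bv

  -- The residual arcs with target t_j (resp. b_i): one per edge at that vertex, forward for
  -- entering edges and backward for leaving ones, so that conservation at the vertex reads
  -- `Balanced`.
  record Star : Set where
    constructor star
    field
      edge₁    : Arc
      adjacent : Fin n → Bool
      family   : ∀ k → T (adjacent k) → Arc
      edge₂    : Arc
  open Star

  data _∈ₛ_ : Arc → Star → Set where
    edge₁∈  : ∀ {σ} → edge₁ σ ∈ₛ σ
    family∈ : ∀ {σ} k c → family σ k c ∈ₛ σ
    edge₂∈  : ∀ {σ} → edge₂ σ ∈ₛ σ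

  count : (Arc → ℕ) → Star → ℕ
  count φ σ = φ (edge₁ σ) + Σℕ (λ k → guardℕ (adjacent σ k) (λ c → φ (family σ k c))) + φ (edge₂ σ)

  count-cong : ∀ σ {φ ψ : Arc → ℕ} → (∀ {x} → x ∈ₛ σ → φ x ≡ ψ x) → count φ σ ≡ count ψ σ
  count-cong σ φ≗ψ =
    cong₂ _+_ (cong₂ _+_ (φ≗ψ edge₁∈) (Σℕ-cong (λ k → guardℕ-cong (adjacent σ k) (φ≗ψ ∘ family∈ k))))
              (φ≗ψ edge₂∈)

  count-zero : ∀ σ → count (λ _ → 0) σ ≡ 0
  count-zero σ = trans (ℕP.+-identityʳ _) (Σℕ-zero (λ k → guardℕ-zero (adjacent σ k) (λ _ → refl)))

  count-+ : ∀ σ (φ ψ : Arc → ℕ) → count (λ x → φ x + ψ x) σ ≡ count φ σ + count ψ σ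
  count-+ σ φ ψ = begin
    φ e + ψ e + Σℕ (λ k → guardℕ (adjacent σ k) (λ c → φ (family σ k c) + ψ (family σ k c))) + (φ e′ + ψ e′)
      ≡⟨ cong (λ z → φ e + ψ e + z + (φ e′ + ψ e′))
              (trans (Σℕ-cong (λ k → guardℕ-+ (adjacent σ k) (φ ∘ family σ k) (ψ ∘ family σ k)))
                     (Σℕ-distrib-+ (λ k → guardℕ (adjacent σ k) (φ ∘ family σ k))
                                   (λ k → guardℕ (adjacent σ k) (ψ ∘ family σ k)))) ⟩
    φ e + ψ e + (Φ + Ψ) + (φ e′ + ψ e′)
      ≡⟨ regroup (φ e) (ψ e) Φ Ψ (φ e′) (ψ e′) ⟩
    φ e + Φ + φ e′ + (ψ e + Ψ + ψ e′) ∎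
    where
    open ≡-Reasoning
    e  = edge₁ σ
    e′ = edge₂ σ
    Φ = Σℕ (λ k → guardℕ (adjacent σ k) (λ c → φ (family σ k c)))
    Ψ = Σℕ (λ k → guardℕ (adjacent σ k) (λ c → ψ (family σ k c)))
    regroup : ∀ a b c d x y → a + b + (c + d) + (x + y) ≡ a + c + x + (b + d + y)
    regroup = ℕSolver.solve-∀

  count-+₃ : ∀ σ (φ ψ χ : Arc → ℕ) → count (λ x → φ x + ψ x + χ x) σ ≡ count φ σ + count ψ σ + count χ σ
  count-+₃ σ φ ψ χ = trans (count-+ σ (λ x → φ x + ψ x) χ) (cong (_+ count χ σ) (count-+ σ φ ψ))

  into : Side → Fin n → Star
  into top    j = star (fwd (eS j)) (λ i → C (hinv i) (hinv j)) (λ i c → fwd (eC i j c)) (bwd (eM j))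
  into bottom i = star (bwd (eT i)) (λ j → C (hinv i) (hinv j)) (λ j c → bwd (eC i j c)) (fwd (eM i))

  into-target : ∀ s i {x} → x ∈ₛ into s i → atgt x ≡ node s i
  into-target top    j edge₁∈        = refl
  into-target top    j (family∈ k c) = refl
  into-target top    j edge₂∈        = refl
  into-target bottom i edge₁∈        = refl
  into-target bottom i (family∈ k c) = refl
  into-target bottom i edge₂∈        = refl

  onFwd onBwd : (Edge → ℕ) → Arc → ℕ
  onFwd f (fwd e) = f e
  onFwd f (bwd e) = 0
  onBwd f (fwd e) = 0
  onBwd f (bwd e) = f e

  Balanced : (Edge → ℕ) → Side → Fin n → Set
  Balanced f s i = count (onFwd f) (into s i) ≡ count (onBwd f) (into s i)

  Balanced-cong : ∀ {f g} → (∀ e → f e ≡ g e) → ∀ s i → Balanced g s i → Balanced f s i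
  Balanced-cong {f} {g} f≗g s i bal =
    trans (count-cong (into s i) (λ {x} _ → onFwd-cong x)) (trans bal (count-cong (into s i) (λ {x} _ → sym (onBwd-cong x))))
    where
    onFwd-cong : ∀ x → onFwd f x ≡ onFwd g x
    onFwd-cong (fwd e) = f≗g e
    onFwd-cong (bwd e) = refl
    onBwd-cong : ∀ x → onBwd f x ≡ onBwd g x
    onBwd-cong (fwd e) = refl
    onBwd-cong (bwd e) = f≗g e

  Balanced-zero : ∀ s i → Balanced (λ _ → 0) s i
  Balanced-zero s i = trans (count-cong (into s i) (λ {x} _ → zero-on x))
                            (sym (count-cong (into s i) (λ {x} _ → zero-on′ x)))
    where
    zero-on : ∀ x → onFwd (λ _ → 0) x ≡ 0
    zero-on (fwd e) = refl
    zero-on (bwd e) = refl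
    zero-on′ : ∀ x → onBwd (λ _ → 0) x ≡ 0
    zero-on′ (fwd e) = refl
    zero-on′ (bwd e) = refl

  Balanced⇒conserve-tv : ∀ f j → Balanced f top j → f (eS j) + Σℕ (λ i → flowC f i j) ≡ f (eM j)
  Balanced⇒conserve-tv f j bal =
    trans (sym (ℕP.+-identityʳ _))
          (trans bal (cong (_+ f (eM j)) (Σℕ-zero (λ k → guardℕ-zero (C (hinv k) (hinv j)) (λ _ → refl)))))

  Balanced⇒conserve-bv : ∀ f i → Balanced f bottom i → f (eM i) ≡ f (eT i) + Σℕ (λ j → flowC f i j)
  Balanced⇒conserve-bv f i bal =
    trans (sym (cong (_+ f (eM i)) (Σℕ-zero (λ k → guardℕ-zero (C (hinv i) (hinv k)) (λ _ → refl)))))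
          (trans bal (ℕP.+-identityʳ _))

  record Invariant (st : State) : Set where
    field
      pot-src        : pot st src ≡ 0ℤ
      flow≤1         : ∀ e → flow st e ≤ 1
      balanced       : ∀ s i → Balanced (flow st) s i
      loaded⇒cost≤Δ  : ∀ e → 1 ≤ flow st e → cost e ≤ℤ Δ st e
      empty⇒Δ≤cost   : ∀ e → flow st e ≡ 0 → Δ st e ≤ℤ cost e
      idle⇒level     : ∀ i → flow st (eM i) ≡ 0 → pot st (tv i) ≡ pot st (bv i)
      pot-sink≤0     : pot st sink ≤ℤ 0ℤ

    conserve-tv : ∀ j → flow st (eS j) + Σℕ (λ i → flowC (flow st) i j) ≡ flow st (eM j)
    conserve-tv j = Balanced⇒conserve-tv (flow st) j (balanced top j)

    conserve-bv : ∀ i → flow st (eM i) ≡ flow st (eT i) + Σℕ (λ j → flowC (flow st) i j)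
    conserve-bv i = Balanced⇒conserve-bv (flow st) i (balanced bottom i)

    Δ-eS : ∀ i → Δ st (eS i) ≡ pot st (tv i)
    Δ-eS i rewrite pot-src = ℤP.+-identityʳ (pot st (tv i))

    idle-bv : ∀ i → flow st (eM i) ≡ 0 → flow st (eT i) ≡ 0 × (∀ j c → flow st (eC i j c) ≡ 0)
    idle-bv i idle =
      ℕP.m+n≡0⇒m≡0 _ out≡0 ,
      λ j c → ℕP.n≤0⇒n≡0 (ℕP.≤-trans (flow-eC≤flowC (flow st) i j c)
                (ℕP.≤-trans (term≤Σℕ (flowC (flow st) i) j) (ℕP.≤-reflexive (ℕP.m+n≡0⇒n≡0 _ out≡0))))
      where
      out≡0 = trans (sym (conserve-bv i)) idle

    in-flow≤1 : ∀ j → flow st (eS j) + Σℕ (λ i → flowC (flow st) i j) ≤ 1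
    in-flow≤1 j = ℕP.≤-trans (ℕP.≤-reflexive (conserve-tv j)) (flow≤1 (eM j))

    out-flow≤1 : ∀ i → flow st (eT i) + Σℕ (λ j → flowC (flow st) i j) ≤ 1
    out-flow≤1 i = ℕP.≤-trans (ℕP.≤-reflexive (sym (conserve-bv i))) (flow≤1 (eM i))

    link⇒source-busy : ∀ {i j} → 1 ≤ flowC (flow st) i j → flow st (eM i) ≡ 1
    link⇒source-busy {i} {j} i→j = ℕP.≤-antisym (flow≤1 (eM i))
      (ℕP.≤-trans i→j (ℕP.≤-trans (term≤Σℕ (flowC (flow st) i) j)
        (ℕP.≤-trans (ℕP.m≤n+m _ (flow st (eT i))) (ℕP.≤-reflexive (sym (conserve-bv i))))))

    link⇒target-busy : ∀ {i j} → 1 ≤ flowC (flow st) i j → flow st (eM j) ≡ 1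
    link⇒target-busy {i} {j} i→j = ℕP.≤-antisym (flow≤1 (eM j))
      (ℕP.≤-trans i→j (ℕP.≤-trans (term≤Σℕ (λ i → flowC (flow st) i j) i)
        (ℕP.≤-trans (ℕP.m≤n+m _ (flow st (eS j))) (ℕP.≤-reflexive (conserve-tv j)))))

    link⇒eS-empty : ∀ {i j} → 1 ≤ flowC (flow st) i j → flow st (eS j) ≡ 0
    link⇒eS-empty {i} {j} i→j =
      m+n≤1⇒1≤n⇒m≡0 _ _ (in-flow≤1 j) (ℕP.≤-trans i→j (term≤Σℕ (λ i → flowC (flow st) i j) i))

    link⇒eT-empty : ∀ {i j} → 1 ≤ flowC (flow st) i j → flow st (eT i) ≡ 0
    link⇒eT-empty {i} {j} i→j =
      m+n≤1⇒1≤n⇒m≡0 _ _ (out-flow≤1 i) (ℕP.≤-trans i→j (term≤Σℕ (flowC (flow st) i) j))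

    fed : ∀ j → flow st (eM j) ≡ 1 → flow st (eS j) ≡ 0 → ∃ λ i → 1 ≤ flowC (flow st) i j
    fed j busy eS-empty = Σℕ-pos⇒pos-term (λ i → flowC (flow st) i j)
      (ℕP.≤-reflexive (sym (trans (cong (_+ Σℕ (λ i → flowC (flow st) i j)) (sym eS-empty)) (trans (conserve-tv j) busy))))

    eS-empty⇒tv≤0 : ∀ i → flow st (eS i) ≡ 0 → pot st (tv i) ≤ℤ 0ℤ
    eS-empty⇒tv≤0 i empty = subst (_≤ℤ 0ℤ) (Δ-eS i) (empty⇒Δ≤cost (eS i) empty)

    busy⇒tv≤bv : ∀ i → flow st (eM i) ≡ 1 → pot st (tv i) ≤ℤ pot st (bv i)
    busy⇒tv≤bv i busy = ℤP.0≤i-j⇒j≤i (loaded⇒cost≤Δ (eM i) (ℕP.≤-reflexive (sym busy)))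

  label-gap : ∀ {a b} → a < b → ℤ.+ a -ℤ ℤ.+ b ≤ℤ -1ℤ
  label-gap {a} {b} a<b = ≤-rearrange (+≤+ a<b) (shuffle (ℤ.+ a) (ℤ.+ b))
    where
    shuffle : ∀ x y → x -ℤ y +ℤ y ≡ -1ℤ +ℤ (1ℤ +ℤ x)
    shuffle = solve-∀

  Δ-initial : ∀ e → Δ initial e ≡ ℤ.+ label (tail e) -ℤ ℤ.+ label (head e)
  Δ-initial e = shuffle (ℤ.+ label (head e)) (ℤ.+ label (tail e))
    where
    shuffle : ∀ x y → -ℤ x -ℤ (-ℤ y) ≡ y -ℤ x
    shuffle = solve-∀

  initial-Δ≤cost : ∀ e → Δ initial e ≤ℤ cost e
  initial-Δ≤cost e = subst (_≤ℤ cost e) (sym (Δ-initial e)) (gap≤cost e)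
    where
    gap≤cost : ∀ e → ℤ.+ label (tail e) -ℤ ℤ.+ label (head e) ≤ℤ cost e
    gap≤cost (eS i)     = ℤP.≤-trans (label-gap (s≤s z≤n)) -≤+
    gap≤cost (eT i)     = label-gap (s≤s (FinP.toℕ<n i))
    gap≤cost (eM i)     = ℤP.≤-reflexive (ℤP.+-inverseʳ (ℤ.+ suc (toℕ i)))
    gap≤cost (eC i j c) = ℤP.≤-trans (label-gap (s≤s (C⇒< i j c))) (-1≤cost (eC i j c))

  initial-invariant : Invariant initial
  initial-invariant = record
    { pot-src       = refl
    ; flow≤1        = λ _ → z≤n
    ; balanced      = Balanced-zero
    ; loaded⇒cost≤Δ = λ _ ()
    ; empty⇒Δ≤cost  = λ e _ → initial-Δ≤cost e
    ; idle⇒level    = λ _ _ → refl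
    ; pot-sink≤0    = -≤+
    }

  Reach-src : ∀ st → Reach st src
  Reach-src st = [] , refl , []

  Reach-step : ∀ {st x} a → Reach st x → asrc a ≡ x → InĒ st a → Reach st (atgt a)
  Reach-step {st} a (as , as-walk , as∈Ē) refl a∈Ē = as ++ a ∷ [] , snoc as as-walk , AllP.++⁺ as∈Ē (a∈Ē ∷ [])
    where
    snoc : ∀ {x} as → IsWalk x as (asrc a) → IsWalk x (as ++ a ∷ []) (atgt a)
    snoc []       refl               = refl , refl
    snoc (b ∷ bs) (b-from , bs-walk) = b-from , snoc bs bs-walk

  walk-vertices : ∀ {x y} as → IsWalk x as y → x ∷ map atgt as ≡ map asrc as ++ y ∷ []
  walk-vertices []       refl               = refl
  walk-vertices (a ∷ as) (a-from , as-walk) = cong₂ _∷_ (sym a-from) (walk-vertices as as-walk)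

  walk-last : ∀ {st x y} a as → IsWalk x (a ∷ as) y → All (InĒ st) (a ∷ as) →
              ∃ λ b → atgt b ≡ y × InĒ st b × ∃ λ bs → IsWalk x bs (asrc b) × All (InĒ st) bs
  walk-last a []        (a-from , refl) (a∈Ē ∷ []) = a , refl , a∈Ē , [] , sym a-from , []
  walk-last a (a′ ∷ as) (a-from , as-walk) (a∈Ē ∷ as∈Ē) with walk-last a′ as as-walk as∈Ē
  ... | b , b-to , b∈Ē , bs , bs-walk , bs∈Ē = b , b-to , b∈Ē , a ∷ bs , (a-from , bs-walk) , a∈Ē ∷ bs∈Ē

  Reach-last : ∀ {st y} → Reach st y → y ≢ src → ∃ λ a → atgt a ≡ y × InĒ st a × Reach st (asrc a)
  Reach-last ([] , refl , [])           y≢src = ⊥-elim (y≢src refl)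
  Reach-last (a ∷ as , as-walk , as∈Ē) _     = walk-last a as as-walk as∈Ē

  Reach-bv⇒Reach-tv : ∀ {st} → Invariant st → ∀ i → flow st (eM i) ≡ 0 → Reach st (bv i) → Reach st (tv i)
  Reach-bv⇒Reach-tv I i idle reach with Reach-last reach (λ ())
  ... | fwd (eM _)     , refl , _            , reach′ = reach′
  ... | bwd (eT _)     , refl , (_ , loaded) , _ = ⊥-elim (ℕP.<-irrefl (sym (proj₁ (Invariant.idle-bv I i idle))) loaded)
  ... | bwd (eC _ j c) , refl , (_ , loaded) , _ = ⊥-elim (ℕP.<-irrefl (sym (proj₂ (Invariant.idle-bv I i idle) j c)) loaded)
  ... | fwd (eS _)     , () , _
  ... | fwd (eT _)     , () , _
  ... | fwd (eC _ _ _) , () , _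
  ... | bwd (eS _)     , () , _
  ... | bwd (eM _)     , () , _

  module Raise {st st′ : State} (I : Invariant st) (sink-below : pot st sink ≤ℤ -1ℤ)
               (sink∉X : ¬ Reach st sink) (same-flow : ∀ e → flow st′ e ≡ flow st e)
               (raised : ∀ x → (Reach st x → pot st′ x ≡ pot st x) ×
                               (¬ Reach st x → pot st′ x ≡ pot st x +ℤ 1ℤ)) where
    open Invariant I

    -- Reach is not decidable, but each goal below is, so we may case on reachability.

    private
      kept : ∀ {x} → Reach st x → pot st′ x ≡ pot st x
      kept = proj₁ (raised _)
      lifted : ∀ {x} → ¬ Reach st x → pot st′ x ≡ pot st x +ℤ 1ℤ
      lifted = proj₂ (raised _)

    Δ′-inside : ∀ e → Reach st (tail e) → Reach st (head e) → Δ st′ e ≡ Δ st e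
    Δ′-inside e rt rh rewrite kept rt | kept rh = refl

    Δ′-outside : ∀ e → ¬ Reach st (tail e) → ¬ Reach st (head e) → Δ st′ e ≡ Δ st e
    Δ′-outside e rt rh rewrite lifted rt | lifted rh = shuffle (pot st (head e)) (pot st (tail e))
      where
      shuffle : ∀ a b → (a +ℤ 1ℤ) -ℤ (b +ℤ 1ℤ) ≡ a -ℤ b
      shuffle = solve-∀

    Δ′-leaving : ∀ e → Reach st (tail e) → ¬ Reach st (head e) → Δ st′ e ≡ ℤ.suc (Δ st e)
    Δ′-leaving e rt rh rewrite kept rt | lifted rh = shuffle (pot st (head e)) (pot st (tail e))
      where
      shuffle : ∀ a b → (a +ℤ 1ℤ) -ℤ b ≡ 1ℤ +ℤ (a -ℤ b)
      shuffle = solve-∀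

    Δ′-entering : ∀ e → ¬ Reach st (tail e) → Reach st (head e) → Δ st′ e ≡ ℤ.pred (Δ st e)
    Δ′-entering e rt rh rewrite lifted rt | kept rh = shuffle (pot st (head e)) (pot st (tail e))
      where
      shuffle : ∀ a b → a -ℤ (b +ℤ 1ℤ) ≡ -1ℤ +ℤ (a -ℤ b)
      shuffle = solve-∀

    loaded⇒cost≤Δ′ : ∀ e → 1 ≤ flow st′ e → cost e ≤ℤ Δ st′ e
    loaded⇒cost≤Δ′ e loaded′ =
      by-excluded-middle (cost e ℤP.≤? Δ st′ e) λ rt? → by-excluded-middle (cost e ℤP.≤? Δ st′ e) λ rh? → go rt? rh?
      where
      loaded = subst (1 ≤_) (same-flow e) loaded′
      old = loaded⇒cost≤Δ e loaded
      go : Dec (Reach st (tail e)) → Dec (Reach st (head e)) → cost e ≤ℤ Δ st′ e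
      go (yes rt) (yes rh) = subst (cost e ≤ℤ_) (sym (Δ′-inside e rt rh)) old
      go (no rt)  (no rh)  = subst (cost e ≤ℤ_) (sym (Δ′-outside e rt rh)) old
      go (yes rt) (no rh)  = subst (cost e ≤ℤ_) (sym (Δ′-leaving e rt rh)) (ℤP.≤-trans old (ℤP.i≤suc[i] _))
      go (no rt)  (yes rh) with cost e ℤP.≟ Δ st e
      ... | yes tight = ⊥-elim (rt (Reach-step (bwd e) rh refl (sym tight , loaded)))
      ... | no slack  = subst (cost e ≤ℤ_) (sym (Δ′-entering e rt rh)) (ℤP.i<j⇒i≤pred[j] (ℤP.≤∧≢⇒< old slack))

    empty⇒Δ′≤cost : ∀ e → flow st′ e ≡ 0 → Δ st′ e ≤ℤ cost e
    empty⇒Δ′≤cost e empty′ =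
      by-excluded-middle (Δ st′ e ℤP.≤? cost e) λ rt? → by-excluded-middle (Δ st′ e ℤP.≤? cost e) λ rh? → go rt? rh?
      where
      empty = trans (sym (same-flow e)) empty′
      old = empty⇒Δ≤cost e empty
      go : Dec (Reach st (tail e)) → Dec (Reach st (head e)) → Δ st′ e ≤ℤ cost e
      go (yes rt) (yes rh) = subst (_≤ℤ cost e) (sym (Δ′-inside e rt rh)) old
      go (no rt)  (no rh)  = subst (_≤ℤ cost e) (sym (Δ′-outside e rt rh)) old
      go (no rt)  (yes rh) = subst (_≤ℤ cost e) (sym (Δ′-entering e rt rh)) (ℤP.i≤j⇒pred[i]≤j old)
      go (yes rt) (no rh) with Δ st e ℤP.≟ cost e
      ... | yes tight = ⊥-elim (rh (Reach-step (fwd e) rt refl (tight , subst (_< 1) (sym empty) (s≤s z≤n))))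
      ... | no slack  = subst (_≤ℤ cost e) (sym (Δ′-leaving e rt rh)) (ℤP.i<j⇒suc[i]≤j (ℤP.≤∧≢⇒< old slack))

    idle⇒level′ : ∀ i → flow st′ (eM i) ≡ 0 → pot st′ (tv i) ≡ pot st′ (bv i)
    idle⇒level′ i idle′ =
      by-excluded-middle (pot st′ (tv i) ℤP.≟ pot st′ (bv i)) λ rt? →
      by-excluded-middle (pot st′ (tv i) ℤP.≟ pot st′ (bv i)) λ rb? → go rt? rb?
      where
      idle = trans (sym (same-flow (eM i))) idle′
      old = idle⇒level i idle
      go : Dec (Reach st (tv i)) → Dec (Reach st (bv i)) → pot st′ (tv i) ≡ pot st′ (bv i)
      go (yes rt) (yes rb) rewrite kept rt | kept rb = old
      go (no rt)  (no rb)  rewrite lifted rt | lifted rb = cong (_+ℤ 1ℤ) old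
      go (no rt)  (yes rb) = ⊥-elim (rt (Reach-bv⇒Reach-tv I i idle rb))
      go (yes rt) (no rb)  = ⊥-elim (rb (Reach-step (fwd (eM i)) rt refl (tight , subst (_< 1) (sym idle) (s≤s z≤n))))
        where
        tight : Δ st (eM i) ≡ 0ℤ
        tight = trans (cong (_-ℤ pot st (tv i)) (sym old)) (ℤP.+-inverseʳ (pot st (tv i)))

    invariant′ : Invariant st′
    invariant′ = record
      { pot-src       = trans (kept (Reach-src st)) pot-src
      ; flow≤1        = λ e → subst (_≤ 1) (sym (same-flow e)) (flow≤1 e)
      ; balanced      = λ s i → Balanced-cong same-flow s i (balanced s i)
      ; loaded⇒cost≤Δ = loaded⇒cost≤Δ′
      ; empty⇒Δ≤cost  = empty⇒Δ′≤cost
      ; idle⇒level    = idle⇒level′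
      ; pot-sink≤0    = subst (_≤ℤ 0ℤ) (sym (lifted sink∉X)) (ℤP.+-monoˡ-≤ 1ℤ sink-below)
      }

  idle⇒pot-sink≤-1 : ∀ {st} → Invariant st → ∀ i → flow st (eS i) ≡ 0 → flow st (eM i) ≡ 0 →
                     pot st sink ≤ℤ -1ℤ
  idle⇒pot-sink≤-1 {st} I i eS-empty idle = ≤-rearrange (eT-slack ⊕ eS-empty⇒tv≤0 i eS-empty) (shuffle s (pot st (tv i)))
    where
    open Invariant I
    s = pot st sink
    eT-slack : s -ℤ pot st (tv i) ≤ℤ -1ℤ
    eT-slack = subst (λ b → s -ℤ b ≤ℤ -1ℤ) (sym (idle⇒level i idle)) (empty⇒Δ≤cost (eT i) (proj₁ (idle-bv i idle)))
    shuffle : ∀ s a → s +ℤ (-1ℤ +ℤ 0ℤ) ≡ -1ℤ +ℤ (s -ℤ a +ℤ a)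
    shuffle = solve-∀

  -- If p(t_{n+1}) ≥ 0, the residual path b₀ → t_i ← b_k → t_{n+1} is tight everywhere.
  fed⇒Reach-sink : ∀ {st} → Invariant st → ∀ i k → flow st (eS i) ≡ 0 → 1 ≤ flowC (flow st) k i →
                   0ℤ ≤ℤ pot st sink → Reach st sink
  fed⇒Reach-sink {st} I i k eS-empty k→i 0≤s =
    fwd (eS i) ∷ bwd (eC k i c) ∷ fwd (eT k) ∷ [] , (refl , refl , refl , refl) ,
    (trans (Δ-eS i) (proj₁ tight) , free eS-empty) ∷ (proj₁ (proj₂ tight) , eC-loaded) ∷
    (proj₂ (proj₂ tight) , free eT-empty) ∷ []
    where
    open Invariant I
    c = proj₁ (guardℕ-pos (C (hinv k) (hinv i)) _ k→i)
    eC-loaded = proj₂ (guardℕ-pos (C (hinv k) (hinv i)) _ k→i)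
    eT-empty = link⇒eT-empty k→i
    tight = three-tight (eS-empty⇒tv≤0 i eS-empty) 0≤s (-1≤cost (eC k i c))
                        (loaded⇒cost≤Δ (eC k i c) eC-loaded) (empty⇒Δ≤cost (eT k) eT-empty)
    free : ∀ {e} → flow st e ≡ 0 → flow st e < 1
    free empty = subst (_< 1) (sym empty) (s≤s z≤n)

  pot-sink≤-1 : ∀ {st} → Invariant st → value st < n → ¬ Reach st sink → pot st sink ≤ℤ -1ℤ
  pot-sink≤-1 {st} I short sink∉X with Σℕ<m⇒zero-term (λ i → flow st (eS i)) short
  ... | i , eS-empty with ≤1⇒0⊎1 (Invariant.flow≤1 I (eM i))
  ...   | inj₁ idle = idle⇒pot-sink≤-1 I i eS-empty idle
  ...   | inj₂ busy with Invariant.fed I i busy eS-empty | pot st sink ℤP.≤? -1ℤ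
  ...     | _       | yes s≤-1 = s≤-1
  ...     | k , k→i | no  s≰-1 =
    ⊥-elim (sink∉X (fed⇒Reach-sink I i k eS-empty k→i (ℤP.i<j⇒suc[i]≤j (ℤP.≰⇒> s≰-1))))

  _≟E_ : DecidableEquality Edge
  _≟E_ = ≡-dec-via-retraction code decode retract (×P.≡-dec ℕP._≟_ (×P.≡-dec FinP._≟_ FinP._≟_))
    where
    code : Edge → ℕ × Fin n × Fin n
    code (eS i)     = 0 , i , i
    code (eT i)     = 1 , i , i
    code (eM i)     = 2 , i , i
    code (eC i j _) = 3 , i , j
    decode : ℕ × Fin n × Fin n → Edge
    decode (0 , i , _) = eS i
    decode (1 , i , _) = eT i
    decode (2 , i , _) = eM i
    decode (_ , i , j) with T? (C (hinv i) (hinv j))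
    ... | yes c = eC i j c
    ... | no  _ = eS i
    retract : ∀ e → decode (code e) ≡ e
    retract (eS i) = refl
    retract (eT i) = refl
    retract (eM i) = refl
    retract (eC i j c) with T? (C (hinv i) (hinv j))
    ... | yes c′ = cong (eC i j) (T-irrelevant c′ c)
    ... | no ¬c  = ⊥-elim (¬c c)

  _≟A_ : DecidableEquality Arc
  _≟A_ = ≡-dec-via-retraction code decode retract (⊎P.≡-dec _≟E_ _≟E_)
    where
    code : Arc → Edge ⊎ Edge
    code (fwd e) = inj₁ e
    code (bwd e) = inj₂ e
    decode : Edge ⊎ Edge → Arc
    decode (inj₁ e) = fwd e
    decode (inj₂ e) = bwd e
    retract : ∀ a → decode (code a) ≡ a
    retract (fwd e) = refl
    retract (bwd e) = refl

  _≟V_ : DecidableEquality (Vtx n)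
  _≟V_ = ≡-dec-via-retraction code decode retract (⊎P.≡-dec _≟ᴮ_ (×P.≡-dec _≟ᴮ_ FinP._≟_))
    where
    code : Vtx n → Bool ⊎ (Bool × Fin n)
    code src    = inj₁ false
    code sink   = inj₁ true
    code (tv i) = inj₂ (false , i)
    code (bv i) = inj₂ (true , i)
    decode : Bool ⊎ (Bool × Fin n) → Vtx n
    decode (inj₁ false)      = src
    decode (inj₁ true)       = sink
    decode (inj₂ (false , i)) = tv i
    decode (inj₂ (true , i))  = bv i
    retract : ∀ x → decode (code x) ≡ x
    retract src    = refl
    retract sink   = refl
    retract (tv i) = refl
    retract (bv i) = refl

  rev : Arc → Arc
  rev (fwd e) = bwd e
  rev (bwd e) = fwd e

  rev-involutive : ∀ a → rev (rev a) ≡ a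
  rev-involutive (fwd e) = refl
  rev-involutive (bwd e) = refl

  asrc-rev : ∀ a → asrc (rev a) ≡ atgt a
  asrc-rev (fwd e) = refl
  asrc-rev (bwd e) = refl

  atgt-rev : ∀ a → atgt (rev a) ≡ asrc a
  atgt-rev (fwd e) = refl
  atgt-rev (bwd e) = refl

  δ : Arc → Arc → ℕ
  δ a x = ind ⌊ x ≟A a ⌋

  δ-self : ∀ a → δ a a ≡ 1
  δ-self a with a ≟A a
  ... | yes _   = refl
  ... | no  a≢a = ⊥-elim (a≢a refl)

  δ-≢ : ∀ {a x} → x ≢ a → δ a x ≡ 0
  δ-≢ {a} {x} x≢a with x ≟A a
  ... | yes x≡a = ⊥-elim (x≢a x≡a)
  ... | no  _   = refl

  δ-rev : ∀ a x → δ a (rev x) ≡ δ (rev a) x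
  δ-rev a x with rev x ≟A a | x ≟A rev a
  ... | yes _       | yes _    = refl
  ... | no  _       | no  _    = refl
  ... | yes refl    | no  x≢   = ⊥-elim (x≢ (sym (rev-involutive x)))
  ... | no  rx≢a    | yes refl = ⊥-elim (rx≢a (rev-involutive a))

  count-δ-edge₁ : ∀ σ → (∀ k c → family σ k c ≢ edge₁ σ) → edge₂ σ ≢ edge₁ σ →
                  count (δ (edge₁ σ)) σ ≡ 1
  count-δ-edge₁ σ fam≢ e₂≢ =
    cong₂ _+_ (cong₂ _+_ (δ-self (edge₁ σ)) (Σℕ-zero (λ k → guardℕ-zero (adjacent σ k) (δ-≢ ∘ fam≢ k)))) (δ-≢ e₂≢)

  count-δ-edge₂ : ∀ σ → (∀ k c → family σ k c ≢ edge₂ σ) → edge₁ σ ≢ edge₂ σ →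
                  count (δ (edge₂ σ)) σ ≡ 1
  count-δ-edge₂ σ fam≢ e₁≢ =
    cong₂ _+_ (cong₂ _+_ (δ-≢ e₁≢) (Σℕ-zero (λ k → guardℕ-zero (adjacent σ k) (δ-≢ ∘ fam≢ k)))) (δ-self (edge₂ σ))

  count-δ-family : ∀ σ k₀ c₀ → (∀ k c → k ≢ k₀ → family σ k c ≢ family σ k₀ c₀) →
                   edge₁ σ ≢ family σ k₀ c₀ → edge₂ σ ≢ family σ k₀ c₀ → count (δ (family σ k₀ c₀)) σ ≡ 1
  count-δ-family σ k₀ c₀ fam≢ e₁≢ e₂≢ = cong₂ _+_ (cong₂ _+_ (δ-≢ e₁≢) at-k₀) (δ-≢ e₂≢)
    where
    at-k₀ : Σℕ (λ k → guardℕ (adjacent σ k) (λ c → δ (family σ k₀ c₀) (family σ k c))) ≡ 1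
    at-k₀ = begin
      Σℕ (λ k → guardℕ (adjacent σ k) (λ c → δ (family σ k₀ c₀) (family σ k c)))
        ≡⟨ Σℕ-single _ k₀ (λ k k≢k₀ → guardℕ-zero (adjacent σ k) (λ c → δ-≢ (fam≢ k c k≢k₀))) ⟩
      guardℕ (adjacent σ k₀) (λ c → δ (family σ k₀ c₀) (family σ k₀ c))
        ≡⟨ guardℕ-at (adjacent σ k₀) _ c₀ ⟩
      δ (family σ k₀ c₀) (family σ k₀ c₀)
        ≡⟨ δ-self _ ⟩
      1 ∎
      where open ≡-Reasoning

  count-into-δ : ∀ s i a → atgt a ≡ node s i → count (δ a) (into s i) ≡ 1
  count-into-δ top j (fwd (eS _))     refl = count-δ-edge₁ (into top j) (λ _ _ ()) (λ ())
  count-into-δ top j (fwd (eC k _ c)) refl =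
    count-δ-family (into top j) k c (λ _ _ k′≢k → λ { refl → k′≢k refl }) (λ ()) (λ ())
  count-into-δ top j (bwd (eM _))     refl = count-δ-edge₂ (into top j) (λ _ _ ()) (λ ())
  count-into-δ top j (fwd (eT _))     ()
  count-into-δ top j (fwd (eM _))     ()
  count-into-δ top j (bwd (eS _))     ()
  count-into-δ top j (bwd (eT _))     ()
  count-into-δ top j (bwd (eC _ _ _)) ()
  count-into-δ bottom i (bwd (eT _))     refl = count-δ-edge₁ (into bottom i) (λ _ _ ()) (λ ())
  count-into-δ bottom i (bwd (eC _ k c)) refl =
    count-δ-family (into bottom i) k c (λ _ _ k′≢k → λ { refl → k′≢k refl }) (λ ()) (λ ())
  count-into-δ bottom i (fwd (eM _))     refl = count-δ-edge₂ (into bottom i) (λ _ _ ()) (λ ())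
  count-into-δ bottom i (fwd (eS _))     ()
  count-into-δ bottom i (fwd (eT _))     ()
  count-into-δ bottom i (fwd (eC _ _ _)) ()
  count-into-δ bottom i (bwd (eS _))     ()
  count-into-δ bottom i (bwd (eM _))     ()

  node≢src : ∀ s i → node s i ≢ src
  node≢src top    i ()
  node≢src bottom i ()

  node≢sink : ∀ s i → node s i ≢ sink
  node≢sink top    i ()
  node≢sink bottom i ()

  module Augmentation {st st′ : State} (I : Invariant st) (as : List Arc) (path : IsPath st as)
                      (augmented : Augment st as (flow st′)) (same-pot : ∀ x → pot st′ x ≡ pot st x) where
    open Invariant I
    open DecMembership _≟A_ using () renaming (_∈?_ to _∈ᴬ?_)
    open DecMembership _≟V_ using () renaming (_∈?_ to _∈ⱽ?_)

    private
      f f′ : Edge → ℕ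
      f  = flow st
      f′ = flow st′

    targets-unique : Unique (map atgt as)
    targets-unique with proj₂ (proj₂ path)
    ... | _ ∷ unique = unique

    sources-unique : Unique (map asrc as)
    sources-unique = Unique-++⁻ˡ (map asrc as) (subst Unique (walk-vertices as (proj₁ path)) (proj₂ (proj₂ path)))

    inner-target⇒source : ∀ s i → node s i ∈ map atgt as → node s i ∈ map asrc as
    inner-target⇒source s i w∈
      with ∈P.∈-++⁻ (map asrc as) (subst (node s i ∈_) (walk-vertices as (proj₁ path)) (there w∈))
    ... | inj₁ w∈sources = w∈sources
    ... | inj₂ (here w≡sink) = ⊥-elim (node≢sink s i w≡sink)

    inner-source⇒target : ∀ s i → node s i ∈ map asrc as → node s i ∈ map atgt as
    inner-source⇒target s i w∈ with subst (node s i ∈_) (sym (walk-vertices as (proj₁ path))) (∈P.∈-++⁺ˡ w∈)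
    ... | here w≡src = ⊥-elim (node≢src s i w≡src)
    ... | there w∈targets = w∈targets

    onPath : Arc → ℕ
    onPath x = ind ⌊ x ∈ᴬ? as ⌋

    onPath-target : ∀ {a x} → a ∈ as → atgt x ≡ atgt a → onPath x ≡ δ a x
    onPath-target {a} {x} a∈ same-target with x ∈ᴬ? as
    ... | yes x∈ rewrite Unique-map⇒injective atgt targets-unique x∈ a∈ same-target = sym (δ-self a)
    ... | no  x∉ = sym (δ-≢ (λ x≡a → x∉ (subst (_∈ as) (sym x≡a) a∈)))

    onPath-source : ∀ {a x} → a ∈ as → asrc x ≡ asrc a → onPath x ≡ δ a x
    onPath-source {a} {x} a∈ same-source with x ∈ᴬ? as
    ... | yes x∈ rewrite Unique-map⇒injective asrc sources-unique x∈ a∈ same-source = sym (δ-self a)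
    ... | no  x∉ = sym (δ-≢ (λ x≡a → x∉ (subst (_∈ as) (sym x≡a) a∈)))

    onPath-off-target : ∀ {w x} → w ∉ map atgt as → atgt x ≡ w → onPath x ≡ 0
    onPath-off-target {w} {x} w∉ x-to with x ∈ᴬ? as
    ... | yes x∈ = ⊥-elim (w∉ (subst (_∈ map atgt as) x-to (∈P.∈-map⁺ atgt x∈)))
    ... | no  _  = refl

    onPath-off-source : ∀ {w x} → w ∉ map asrc as → asrc x ≡ w → onPath x ≡ 0
    onPath-off-source {w} {x} w∉ x-from with x ∈ᴬ? as
    ... | yes x∈ = ⊥-elim (w∉ (subst (_∈ map asrc as) x-from (∈P.∈-map⁺ asrc x∈)))
    ... | no  _  = refl

    arrivals≡departures : ∀ s i → count onPath (into s i) ≡ count (onPath ∘ rev) (into s i)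
    arrivals≡departures s i with node s i ∈ⱽ? map atgt as
    ... | yes w∈targets = trans (arrivals w∈targets) (sym (departures (inner-target⇒source s i w∈targets)))
      where
      arrivals : node s i ∈ map atgt as → count onPath (into s i) ≡ 1
      arrivals w∈ with ∈P.∈-map⁻ atgt w∈
      ... | a , a∈ , w≡ =
        trans (count-cong (into s i) (λ {x} x∈ → onPath-target {x = x} a∈ (trans (into-target s i x∈) w≡)))
              (count-into-δ s i a (sym w≡))
      departures : node s i ∈ map asrc as → count (onPath ∘ rev) (into s i) ≡ 1
      departures w∈ with ∈P.∈-map⁻ asrc w∈
      ... | b , b∈ , w≡ =
        trans (count-cong (into s i) (λ {x} x∈ →
                 trans (onPath-source {x = rev x} b∈ (trans (asrc-rev x) (trans (into-target s i x∈) w≡))) (δ-rev b x)))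
              (count-into-δ s i (rev b) (trans (atgt-rev b) (sym w≡)))
    ... | no w∉targets = trans no-arrivals (sym no-departures)
      where
      w∉sources : node s i ∉ map asrc as
      w∉sources = w∉targets ∘ inner-source⇒target s i
      no-arrivals : count onPath (into s i) ≡ 0
      no-arrivals = trans (count-cong (into s i) (λ {x} x∈ → onPath-off-target {x = x} w∉targets (into-target s i x∈)))
                          (count-zero (into s i))
      no-departures : count (onPath ∘ rev) (into s i) ≡ 0
      no-departures = trans (count-cong (into s i) (λ {x} x∈ →
                              onPath-off-source {x = rev x} w∉sources (trans (asrc-rev x) (into-target s i x∈))))
                            (count-zero (into s i))

    flow-shift : ∀ e → f′ e + onPath (bwd e) ≡ f e + onPath (fwd e)
    flow-shift e with fwd e ∈ᴬ? as | bwd e ∈ᴬ? as | augmented e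
    ... | yes fwd∈ | yes bwd∈ | up , down , _ =
      ⊥-elim (ℕP.<⇒≢ (ℕP.m<n⇒m<1+n (ℕP.n<1+n (f e))) (trans (sym (down bwd∈)) (cong suc (up fwd∈))))
    ... | yes fwd∈ | no _     | up , _ , _    = trans (ℕP.+-identityʳ _) (trans (up fwd∈) (ℕP.+-comm 1 (f e)))
    ... | no _     | yes bwd∈ | _ , down , _  = trans (ℕP.+-comm (f′ e) 1) (trans (down bwd∈) (sym (ℕP.+-identityʳ _)))
    ... | no fwd∉  | no bwd∉  | _ , _ , same  = cong (_+ 0) (same fwd∉ bwd∉)

    reroute : ∀ a → onFwd f′ a + onBwd f a + onPath (rev a) ≡ onFwd f a + onBwd f′ a + onPath a
    reroute (fwd e) = begin
      f′ e + 0 + onPath (bwd e) ≡⟨ cong (_+ onPath (bwd e)) (ℕP.+-identityʳ (f′ e)) ⟩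
      f′ e + onPath (bwd e)     ≡⟨ flow-shift e ⟩
      f e + onPath (fwd e)      ≡⟨ cong (_+ onPath (fwd e)) (sym (ℕP.+-identityʳ (f e))) ⟩
      f e + 0 + onPath (fwd e)  ∎
      where open ≡-Reasoning
    reroute (bwd e) = sym (flow-shift e)

    balanced′ : ∀ s i → Balanced f′ s i
    balanced′ s i = balance-transfer reroute-count (balanced s i) (arrivals≡departures s i)
      where
      σ = into s i
      reroute-count : count (onFwd f′) σ + count (onBwd f) σ + count (onPath ∘ rev) σ
                    ≡ count (onFwd f) σ + count (onBwd f′) σ + count onPath σ
      reroute-count = begin
        count (onFwd f′) σ + count (onBwd f) σ + count (onPath ∘ rev) σ
          ≡⟨ sym (count-+₃ σ (onFwd f′) (onBwd f) (onPath ∘ rev)) ⟩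
        count (λ a → onFwd f′ a + onBwd f a + onPath (rev a)) σ
          ≡⟨ count-cong σ (λ {a} _ → reroute a) ⟩
        count (λ a → onFwd f a + onBwd f′ a + onPath a) σ
          ≡⟨ count-+₃ σ (onFwd f) (onBwd f′) onPath ⟩
        count (onFwd f) σ + count (onBwd f′) σ + count onPath σ ∎
        where open ≡-Reasoning

    changed⇒tight : ∀ e → f′ e ≡ f e ⊎ Tight st e
    changed⇒tight e with fwd e ∈ᴬ? as | bwd e ∈ᴬ? as
    ... | yes fwd∈ | _        = inj₂ (proj₁ (All.lookup (proj₁ (proj₂ path)) fwd∈))
    ... | no _     | yes bwd∈ = inj₂ (proj₁ (All.lookup (proj₁ (proj₂ path)) bwd∈))
    ... | no fwd∉  | no bwd∉  = inj₁ (proj₂ (proj₂ (augmented e)) fwd∉ bwd∉)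

    flow′≤1 : ∀ e → f′ e ≤ 1
    flow′≤1 e with fwd e ∈ᴬ? as | bwd e ∈ᴬ? as | augmented e
    ... | yes fwd∈ | _        | up , _ , _   = subst (_≤ 1) (sym (up fwd∈)) (proj₂ (All.lookup (proj₁ (proj₂ path)) fwd∈))
    ... | no _     | yes bwd∈ | _ , down , _ = ℕP.≤-trans (ℕP.n≤1+n _) (subst (_≤ 1) (sym (down bwd∈)) (flow≤1 e))
    ... | no fwd∉  | no bwd∉  | _ , _ , same = subst (_≤ 1) (sym (same fwd∉ bwd∉)) (flow≤1 e)

    Δ′≡Δ : ∀ e → Δ st′ e ≡ Δ st e
    Δ′≡Δ e rewrite same-pot (head e) | same-pot (tail e) = refl

    invariant′ : Invariant st′
    invariant′ = record
      { pot-src       = trans (same-pot src) pot-src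
      ; flow≤1        = flow′≤1
      ; balanced      = balanced′
      ; loaded⇒cost≤Δ = λ e loaded → subst (cost e ≤ℤ_) (sym (Δ′≡Δ e)) (loaded′ e loaded (changed⇒tight e))
      ; empty⇒Δ≤cost  = λ e empty → subst (_≤ℤ cost e) (sym (Δ′≡Δ e)) (empty′ e empty (changed⇒tight e))
      ; idle⇒level    = level′
      ; pot-sink≤0    = subst (_≤ℤ 0ℤ) (sym (same-pot sink)) pot-sink≤0
      }
      where
      loaded′ : ∀ e → 1 ≤ f′ e → f′ e ≡ f e ⊎ Tight st e → cost e ≤ℤ Δ st e
      loaded′ e loaded (inj₁ same)  = loaded⇒cost≤Δ e (subst (1 ≤_) same loaded)
      loaded′ e loaded (inj₂ tight) = ℤP.≤-reflexive (sym tight)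
      empty′ : ∀ e → f′ e ≡ 0 → f′ e ≡ f e ⊎ Tight st e → Δ st e ≤ℤ cost e
      empty′ e empty (inj₁ same)  = empty⇒Δ≤cost e (trans (sym same) empty)
      empty′ e empty (inj₂ tight) = ℤP.≤-reflexive tight
      level′ : ∀ i → f′ (eM i) ≡ 0 → pot st′ (tv i) ≡ pot st′ (bv i)
      level′ i idle rewrite same-pot (tv i) | same-pot (bv i) with changed⇒tight (eM i)
      ... | inj₁ same  = idle⇒level i (trans (sym same) idle)
      ... | inj₂ tight = sym (ℤP.i-j≡0⇒i≡j _ _ tight)

  value≥n⇒max : ∀ st → n ≤ value st → IsMaxFlow st
  value≥n⇒max st n≤v g (bounds , _) = Σℚ≤size n (value st) (λ i → g (eS i)) (λ i → proj₂ (bounds (eS i))) n≤v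

  -- The first step starts from p(t_{n+1}) = −(n+1); later steps are taken only when the
  -- flow is not maximum, i.e. has value < n.
  step-invariant : ∀ {st st′} → Invariant st → pot st sink ≤ℤ -1ℤ ⊎ value st < n → Step st st′ → Invariant st′
  step-invariant I _   (augment st′ _ as path augmented same-pot) = Augmentation.invariant′ I as path augmented same-pot
  step-invariant I (inj₁ below) (raise st′ sink∉X same-flow raised) = Raise.invariant′ I below sink∉X same-flow raised
  step-invariant I (inj₂ short) (raise st′ sink∉X same-flow raised) =
    Raise.invariant′ I (pot-sink≤-1 I short sink∉X) sink∉X same-flow raised

  Stage⇒Invariant : ∀ {st} → Stage st → Invariant st
  Stage⇒Invariant start                  = initial-invariant
  Stage⇒Invariant (first step)           = step-invariant initial-invariant (inj₁ (-≤- z≤n)) step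
  Stage⇒Invariant (next {st} stage not-max step) =
    step-invariant (Stage⇒Invariant stage) (inj₂ (ℕP.≰⇒> (not-max ∘ value≥n⇒max st))) step

  module FlowPaths {st : State} (I : Invariant st) where
    open Invariant I

    private
      f : Edge → ℕ
      f = flow st
      π : Vtx n → ℤ
      π = pot st

    IsSuccessor : Fin n → Maybe (Fin n) → Set
    IsSuccessor i nothing  = ∀ j → flowC f i j ≡ 0
    IsSuccessor i (just j) = 1 ≤ flowC f i j

    successor : Fin n → Maybe (Fin n)
    successor i with FinP.any? (λ j → 1 ℕP.≤? flowC f i j)
    ... | yes (j , _) = just j
    ... | no  _       = nothing

    successor-spec : ∀ i → IsSuccessor i (successor i)
    successor-spec i with FinP.any? (λ j → 1 ℕP.≤? flowC f i j)
    ... | yes (_ , loaded) = loaded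
    ... | no  none         = λ j → ℕP.n<1⇒n≡0 (ℕP.≰⇒> (λ loaded → none (j , loaded)))

    successor⇒loaded : ∀ {i j} → successor i ≡ just j → 1 ≤ flowC f i j
    successor⇒loaded {i} eq = subst (IsSuccessor i) eq (successor-spec i)

    loaded⇒< : ∀ {i j} → 1 ≤ flowC f i j → toℕ i < toℕ j
    loaded⇒< {i} {j} loaded = C⇒< i j (proj₁ (guardℕ-pos (C (hinv i) (hinv j)) _ loaded))

    two-out-links : ∀ {k j i} → j ≢ i → 1 ≤ flowC f k j → 1 ≤ flowC f k i → ⊥
    two-out-links {k} {j} {i} j≢i k→j k→i = ℕP.<-irrefl refl (ℕP.≤-trans (ℕP.+-mono-≤ k→j k→i)
      (ℕP.≤-trans (two-terms≤Σℕ (flowC f k) j i j≢i) (ℕP.≤-trans (ℕP.m≤n+m _ (f (eT k))) (out-flow≤1 k))))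

    two-in-links : ∀ {y z z′} → z ≢ z′ → 1 ≤ flowC f z y → 1 ≤ flowC f z′ y → ⊥
    two-in-links {y} {z} {z′} z≢z′ z→y z′→y = ℕP.<-irrefl refl (ℕP.≤-trans (ℕP.+-mono-≤ z→y z′→y)
      (ℕP.≤-trans (two-terms≤Σℕ (λ i → flowC f i y) z z′ z≢z′)
                  (ℕP.≤-trans (ℕP.m≤n+m _ (f (eS y))) (in-flow≤1 y))))

    loaded⇒successor : ∀ {k i} → 1 ≤ flowC f k i → successor k ≡ just i
    loaded⇒successor {k} {i} k→i with successor k | successor-spec k
    ... | nothing | none = ⊥-elim (ℕP.<-irrefl (sym (none i)) k→i)
    ... | just j  | k→j with j FinP.≟ i
    ...   | yes j≡i = cong just j≡i
    ...   | no  j≢i = ⊥-elim (two-out-links j≢i k→j k→i)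

    predecessor-unique : ∀ {y z z′} → successor z ≡ just y → successor z′ ≡ just y → z ≡ z′
    predecessor-unique {y} {z} {z′} z→y z′→y with z FinP.≟ z′
    ... | yes z≡z′ = z≡z′
    ... | no  z≢z′ = ⊥-elim (two-in-links z≢z′ (successor⇒loaded z→y) (successor⇒loaded z′→y))

    start-no-predecessor : ∀ {y z} → f (eS y) ≡ 1 → successor z ≢ just y
    start-no-predecessor {y} {z} y-start z→y = ℕP.<-irrefl refl
      (ℕP.≤-trans (ℕP.+-mono-≤ (ℕP.≤-reflexive (sym y-start)) (successor⇒loaded z→y))
        (ℕP.≤-trans (ℕP.+-monoʳ-≤ (f (eS y)) (term≤Σℕ (λ i → flowC f i y) z)) (in-flow≤1 y)))

    -- Follows the flow out of b_i; labels increase along it, so fuel n is never exhausted.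
    walkTail : ℕ → Fin n → List (Fin n)
    walkTail zero    i = []
    walkTail (suc k) i = maybe′ (λ j → j ∷ walkTail k j) [] (successor i)

    walk : ℕ → Fin n → List (Fin n)
    walk k i = i ∷ walkTail k i

    walkTail-> : ∀ k i {x} → x ∈ walkTail k i → toℕ i < toℕ x
    walkTail-> (suc k) i x∈ with successor i | successor-spec i
    ... | just j | i→j with x∈
    ...   | here refl = loaded⇒< i→j
    ...   | there x∈′ = ℕP.<-trans (loaded⇒< i→j) (walkTail-> k j x∈′)

    walk-unique : ∀ k i → Unique (walk k i)
    walk-unique k i = All.tabulate (λ x∈ i≡x → ℕP.<-irrefl (cong toℕ i≡x) (walkTail-> k i x∈)) ∷ tail-unique k i
      where
      tail-unique : ∀ k i → Unique (walkTail k i)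
      tail-unique zero    i = []
      tail-unique (suc k) i with successor i
      ... | nothing = []
      ... | just j  = walk-unique k j

    walk-adjacentable : ∀ k i → Adjacentable (map hinv (walk k i))
    walk-adjacentable zero    i = _
    walk-adjacentable (suc k) i with successor i | successor-spec i
    ... | nothing | _   = _
    ... | just j  | i→j = proj₁ (guardℕ-pos (C (hinv i) (hinv j)) _ i→j) , walk-adjacentable k j

    fuel-exhausted : ∀ i → ¬ (n ≤ toℕ i + 0)
    fuel-exhausted i fuel = ℕP.<⇒≱ (FinP.toℕ<n i) (subst (n ≤_) (ℕP.+-identityʳ (toℕ i)) fuel)

    fuel-step : ∀ {i j : Fin n} {k} → n ≤ toℕ i + suc k → toℕ i < toℕ j → n ≤ toℕ j + k
    fuel-step {i} {j} {k} fuel i<j =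
      ℕP.≤-trans fuel (ℕP.≤-trans (ℕP.≤-reflexive (ℕP.+-suc (toℕ i) k)) (ℕP.+-monoˡ-≤ k i<j))

    s : ℤ
    s = π sink

    inside : Fin n → Bool
    inside i = levelIn s (π (tv i)) (π (bv i))

    outside : Fin n → ℕ
    outside i = ind (not (inside i))

    outsideOn : List (Fin n) → ℕ
    outsideOn xs = sum (map outside xs)

    potential-along-walk : ∀ k i → f (eM i) ≡ 1 → n ≤ toℕ i + k →
      π (tv i) +ℤ ℤ.+ outsideOn (walk k i) ≤ℤ ℤ.+ asc (map hinv (walk k i)) +ℤ s +ℤ ℤ.+ positive (π (tv i))
    potential-along-walk zero    i busy fuel = ⊥-elim (fuel-exhausted i fuel)
    potential-along-walk (suc k) i busy fuel with successor i | successor-spec i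
    ... | nothing | none =
      subst (λ o → π (tv i) +ℤ ℤ.+ o ≤ℤ 1ℤ +ℤ s +ℤ ℤ.+ positive (π (tv i))) (sym (ℕP.+-identityʳ (outside i)))
        (levelOut-last pot-sink≤0 (busy⇒tv≤bv i busy)
                       (-1≤i-j⇒j≤i+1 {i = s} (loaded⇒cost≤Δ (eT i) (ℕP.≤-reflexive (sym eT-loaded)))))
      where
      eT-loaded : f (eT i) ≡ 1
      eT-loaded = trans (sym (ℕP.+-identityʳ _))
                        (trans (cong (f (eT i) +_) (sym (Σℕ-zero none))) (trans (sym (conserve-bv i)) busy))
    ... | just j  | i→j =
      subst (λ a → π (tv i) +ℤ ℤ.+ (outside i + outsideOn (walk k j)) ≤ℤ ℤ.+ a +ℤ s +ℤ ℤ.+ positive (π (tv i)))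
        (ℕP.+-suc (ind (lt (hinv i) (hinv j))) (ascPairs (map hinv (walk k j))))
        (chain-step {x = π (tv i)} {y = π (bv i)} {x′ = π (tv j)} {B′ = ℤ.+ outsideOn (walk k j)}
                    {L = ℤ.+ ind (lt (hinv i) (hinv j))} {a = ℤ.+ asc (map hinv (walk k j))} {s = s}
                    (levelOut-middle pot-sink≤0 (busy⇒tv≤bv i busy)
                                     (i-j≤-1⇒i+1≤j {i = s} (empty⇒Δ≤cost (eT i) (link⇒eT-empty i→j))))
                    (subst (_≤ℤ π (tv j) -ℤ π (bv i)) (cost-eC i j c) (loaded⇒cost≤Δ (eC i j c) eC-loaded))
                    (subst (π (tv j) +ℤ ℤ.+ outsideOn (walk k j) ≤ℤ_)
                           (ℤP.+-identityʳ (ℤ.+ asc (map hinv (walk k j)) +ℤ s)) rest))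
      where
      c = proj₁ (guardℕ-pos (C (hinv i) (hinv j)) _ i→j)
      eC-loaded = proj₂ (guardℕ-pos (C (hinv i) (hinv j)) _ i→j)
      rest : π (tv j) +ℤ ℤ.+ outsideOn (walk k j) ≤ℤ ℤ.+ asc (map hinv (walk k j)) +ℤ s +ℤ 0ℤ
      rest = subst (λ p → π (tv j) +ℤ ℤ.+ outsideOn (walk k j) ≤ℤ ℤ.+ asc (map hinv (walk k j)) +ℤ s +ℤ ℤ.+ p)
               (positive-nonpos (eS-empty⇒tv≤0 j (link⇒eS-empty i→j)))
               (potential-along-walk k j (link⇒target-busy i→j) (fuel-step fuel (loaded⇒< i→j)))

    outsideOn-walk+∣s∣≤asc : ∀ a → f (eS a) ≡ 1 → outsideOn (walk n a) + ∣ s ∣ ≤ asc (map hinv (walk n a))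
    outsideOn-walk+∣s∣≤asc a a-start = ℤP.drop‿+≤+ (≤-rearrange B≤A-∣s∣ (shuffle B A (ℤ.+ ∣ s ∣)))
      where
      B = ℤ.+ outsideOn (walk n a)
      A = ℤ.+ asc (map hinv (walk n a))
      x = π (tv a)
      eM-loaded : f (eM a) ≡ 1
      eM-loaded = ℕP.≤-antisym (flow≤1 (eM a))
        (subst (_≤ f (eM a)) a-start (ℕP.≤-trans (ℕP.m≤m+n _ _) (ℕP.≤-reflexive (conserve-tv a))))
      0≤x : 0ℤ ≤ℤ x
      0≤x = subst (0ℤ ≤ℤ_) (Δ-eS a) (loaded⇒cost≤Δ (eS a) (ℕP.≤-reflexive (sym a-start)))
      B≤A+s : B ≤ℤ A +ℤ s
      B≤A+s = ≤-rearrange (potential-along-walk n a eM-loaded (ℕP.m≤n+m n (toℕ a)) ⊕ positive≤ 0≤x)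
                          (shuffle′ x B A s (ℤ.+ positive x))
        where
        shuffle′ : ∀ x B A s p → B +ℤ (A +ℤ s +ℤ p +ℤ x) ≡ A +ℤ s +ℤ (x +ℤ B +ℤ p)
        shuffle′ = solve-∀
      B≤A-∣s∣ : B ≤ℤ A +ℤ -ℤ (ℤ.+ ∣ s ∣)
      B≤A-∣s∣ = subst (λ z → B ≤ℤ A +ℤ z) (sym (-∣i∣≡i pot-sink≤0)) B≤A+s
      shuffle : ∀ B A P → B +ℤ P +ℤ (A +ℤ -ℤ P) ≡ A +ℤ B
      shuffle = solve-∀

    starts : List (Fin n)
    starts = support (λ i → f (eS i))

    ∈-starts⇒loaded : ∀ {a} → a ∈ starts → f (eS a) ≡ 1
    ∈-starts⇒loaded a∈ = ℕP.≤-antisym (flow≤1 (eS _)) (∈-support⁻ (λ i → f (eS i)) a∈)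

    walk-closed : ∀ K a {k i} → n ≤ toℕ a + K → k ∈ walk K a → successor k ≡ just i → i ∈ walk K a
    walk-closed zero    a fuel _ _ = ⊥-elim (fuel-exhausted a fuel)
    walk-closed (suc K) a fuel k∈ k→i with successor a in a→
    walk-closed (suc K) a fuel (here refl) k→i | nothing with trans (sym a→) k→i
    ... | ()
    walk-closed (suc K) a fuel (here refl) k→i | just j with trans (sym a→) k→i
    ... | refl = there (here refl)
    walk-closed (suc K) a fuel (there k∈) k→i | just j =
      there (walk-closed K j (fuel-step fuel (loaded⇒< (successor⇒loaded a→))) k∈ k→i)

    loaded⇒on-walk : ∀ d i → toℕ i < d → f (eM i) ≡ 1 → ∃ λ a → a ∈ starts × i ∈ walk n a
    loaded⇒on-walk (suc d) i i<d busy with ≤1⇒0⊎1 (flow≤1 (eS i))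
    ... | inj₂ i-start = i , ∈-support⁺ (λ i → f (eS i)) (ℕP.≤-reflexive (sym i-start)) , here refl
    ... | inj₁ eS-empty with fed i busy eS-empty
    ...   | k , k→i with loaded⇒on-walk d k (ℕP.<-≤-trans (loaded⇒< k→i) (ℕP.≤-pred i<d)) (link⇒source-busy k→i)
    ...     | a , a∈ , k∈ = a , a∈ , walk-closed n a (ℕP.m≤n+m n (toℕ a)) k∈ (loaded⇒successor k→i)

    walk-predecessor : ∀ K a {y} → y ∈ walk K a → y ≡ a ⊎ ∃ λ z → z ∈ walk K a × successor z ≡ just y
    walk-predecessor K       a (here y≡a) = inj₁ y≡a
    walk-predecessor (suc K) a (there y∈) with successor a in a→
    ... | just j with walk-predecessor K j y∈
    ...   | inj₁ refl              = inj₂ (a , here refl , a→)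
    ...   | inj₂ (z , z∈ , z→y)    = inj₂ (z , there z∈ , z→y)

    walks-meet⇒same-start : ∀ d y → toℕ y < d → ∀ {a b} → f (eS a) ≡ 1 → f (eS b) ≡ 1 →
                            y ∈ walk n a → y ∈ walk n b → a ≡ b
    walks-meet⇒same-start (suc d) y y<d {a} {b} a-start b-start y∈a y∈b
      with walk-predecessor n a y∈a | walk-predecessor n b y∈b
    ... | inj₁ y≡a            | inj₁ y≡b              = trans (sym y≡a) y≡b
    ... | inj₁ refl           | inj₂ (z , _ , z→y)    = ⊥-elim (start-no-predecessor a-start z→y)
    ... | inj₂ (z , _ , z→y)  | inj₁ refl             = ⊥-elim (start-no-predecessor b-start z→y)
    ... | inj₂ (z , z∈ , z→y) | inj₂ (z′ , z′∈ , z′→y) =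
      walks-meet⇒same-start d z (ℕP.<-≤-trans (loaded⇒< (successor⇒loaded z→y)) (ℕP.≤-pred y<d)) a-start b-start
        z∈ (subst (_∈ walk n b) (sym (predecessor-unique z→y z′→y)) z′∈)

    private
      v = value st

    v≡#starts : v ≡ length starts
    v≡#starts = sym (length-support (λ i → f (eS i)) (λ i → flow≤1 (eS i)))

    startOf : Fin v → Fin n
    startOf k = lookup starts (cast v≡#starts k)

    startOf-loaded : ∀ k → f (eS (startOf k)) ≡ 1
    startOf-loaded k = ∈-starts⇒loaded (∈P.∈-lookup (cast v≡#starts k))

    flowFamily : Fin v → List (Fin n)
    flowFamily k = map hinv (walk n (startOf k))

    flowFamily-disjoint : ∀ k l → k ≢ l → ∀ x → x ∈ flowFamily k → x ∉ flowFamily l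
    flowFamily-disjoint k l k≢l x x∈k x∈l with ∈P.∈-map⁻ hinv x∈k | ∈P.∈-map⁻ hinv x∈l
    ... | y , y∈ , x≡hy | y′ , y′∈ , x≡hy′ = k≢l (cast-injective v≡#starts
          (lookup-injective (support-unique (λ i → f (eS i))) _ _
            (walks-meet⇒same-start (suc (toℕ y)) y ℕP.≤-refl (startOf-loaded k) (startOf-loaded l) y∈
              (subst (_∈ walk n (startOf l)) (sym (hinv-injective (trans (sym x≡hy) x≡hy′))) y′∈))))

    flowFamily-isFamily : IsFamily v flowFamily
    flowFamily-isFamily =
      (λ k → UniqueP.map⁺ hinv-injective (walk-unique n (startOf k)) , walk-adjacentable n (startOf k)) , flowFamily-disjoint

    outside⇒busy : ∀ i → T (not (inside i)) → f (eM i) ≡ 1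
    outside⇒busy i out with ≤1⇒0⊎1 (flow≤1 (eM i))
    ... | inj₂ busy = busy
    ... | inj₁ idle = ⊥-elim (subst (T ∘ not) i-inside out)
      where
      level = idle⇒level i idle
      s+1≤tv : s +ℤ 1ℤ ≤ℤ π (tv i)
      s+1≤tv = subst (s +ℤ 1ℤ ≤ℤ_) (sym level)
                     (i-j≤-1⇒i+1≤j {i = s} (empty⇒Δ≤cost (eT i) (proj₁ (idle-bv i idle))))
      tv≤0 : π (tv i) ≤ℤ 0ℤ
      tv≤0 = eS-empty⇒tv≤0 i (ℕP.m+n≡0⇒m≡0 _ (trans (conserve-tv i) idle))
      i-inside : inside i ≡ true
      i-inside = levelIn-true pot-sink≤0 level s+1≤tv tv≤0

    outside-covered : countFin (not ∘ inside) ≤ sum (map (outsideOn ∘ walk n) starts)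
    outside-covered = ℕP.≤-trans (countFin≤count-cover _ (concatMap (walk n) starts) covered)
                                 (ℕP.≤-reflexive (sum-map-concatMap outside (walk n) starts))
      where
      covered : ∀ i → T (not (inside i)) → i ∈ concatMap (walk n) starts
      covered i out with loaded⇒on-walk (suc (toℕ i)) i ℕP.≤-refl (outside⇒busy i out)
      ... | a , a∈ , i∈ = ∈P.∈-concat⁺′ i∈ (∈P.∈-map⁺ (walk n) a∈)

    n+v∣s∣≤Pcount+m : ∀ m → (∀ F → IsFamily v F → totalAsc v F ≤ m) → n + v * ∣ s ∣ ≤ Pcount st + m
    n+v∣s∣≤Pcount+m m maximal = begin
      n + v * ∣ s ∣
        ≡⟨ cong (_+ v * ∣ s ∣) (sym (countFin-true+false inside)) ⟩
      countFin inside + countFin (not ∘ inside) + v * ∣ s ∣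
        ≡⟨ ℕP.+-assoc (countFin inside) _ _ ⟩
      countFin inside + (countFin (not ∘ inside) + v * ∣ s ∣)
        ≤⟨ ℕP.+-monoʳ-≤ (countFin inside)
             (ℕP.+-mono-≤ outside-covered (ℕP.≤-reflexive (cong (_* ∣ s ∣) v≡#starts))) ⟩
      countFin inside + (sum (map (outsideOn ∘ walk n) starts) + length starts * ∣ s ∣)
        ≤⟨ ℕP.+-monoʳ-≤ (countFin inside)
             (sum-map-shift-≤ (outsideOn ∘ walk n) ascOfWalk ∣ s ∣ starts
               (λ a∈ → outsideOn-walk+∣s∣≤asc _ (∈-starts⇒loaded a∈))) ⟩
      countFin inside + sum (map ascOfWalk starts)
        ≡⟨ cong (countFin inside +_) (sym (Σℕ-lookup starts v≡#starts ascOfWalk)) ⟩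
      countFin inside + totalAsc v flowFamily
        ≤⟨ ℕP.+-monoʳ-≤ (countFin inside) (maximal flowFamily flowFamily-isFamily) ⟩
      countFin inside + m ∎
      where
      open ℕP.≤-Reasoning
      ascOfWalk : Fin n → ℕ
      ascOfWalk a = asc (map hinv (walk n a))

proposition5p2 : (n : ℕ) (S : Setup n) (st : Network.State S) →
    Network.Stage S st →
    ∀ m → Sequences.IsA' S (Network.value S st) m →
    Network.Pcount S st + m ≥ n + Network.value S st * ∣ Network.State.pot st sink ∣
proposition5p2 n S st stage m (_ , maximal) =
  Algorithm.FlowPaths.n+v∣s∣≤Pcount+m S (Algorithm.Stage⇒Invariant S stage) m maximal
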